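{- Let $m,n$ be positive integers and let $\mathcal{R}=(r_1,\ldots,r_m)$, $\mathcal{C}=(c_1,\ldots,c_n)$ be sequences of integers with $n=r_1\ge r_2\ge\cdots\ge r_m$ and $m=c_1\ge c_2\ge\cdots\ge c_n$, and assume that $(\mathcal{R},\mathcal{C})$ is consistent. Start from the uniquely determined neighbour $F_1$ and run the procedure described in the context (repeatedly applying A-steps or B-steps, each of which fixes and deletes one column, until the current $d_i$ are all $0$), and then put all deleted columns back in their original positions. Then this procedure can be carried out until it stops, and the resulting set $F_2$ has row sums $\mathcal{R}$ and column sums $\mathcal{C}$.
   Context: For a finite set $F\subseteq\mathbb{Z}^2$, row $i$ is $\{(i,l)\}$ and column $j$ is $\{(k,j)\}$ (matrix convention: first coordinate is the row index). The row sum $r_i$ is the number of points of $F$ in row $i$ and the column sum $c_j$ the number of points of $F$ in column $j$. The pair $(\mathcal{R},\mathcal{C})$ is consistent if there exists $F\subseteq\{1,\ldots,m\}\times\{1,\ldots,n\}$ with row sums $r_1,\ldots,r_m$ and column sums $c_1,\ldots,c_n$. The uniquely determined neighbour is $F_1=\{(i,j):1\le j\le n,\ 1\le i\le c_j\}$; its row sums are $b_i=\#\{j:c_j\ge i\}$. The procedure. A state consists of a set $J\subseteq\{1,\ldots,n\}$ of remaining columns (initially all $n$ columns, with their original column sums $c_j$) and current row sums $r_1,\ldots,r_m$ (initially the given ones). In the current state set $b_i=\#\{j\in J: c_j\ge i\}$, $d_i=b_i-r_i$ for $1\le i\le m$, and $r_{m+1}=b_{m+1}=d_{m+1}=0$.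 If $d_i=0$ for all $i$, the procedure stops. Otherwise let $i_1$ be minimal with $d_{i_1}>0$, $i_2$ minimal with $d_{i_2}>0$ and $d_{i_2+1}\le 0$, $R^+=\{i_1,\ldots,i_2\}$; let $i_3$ be minimal with $d_{i_3}<0$, $i_4$ minimal with $d_{i_4}<0$ and $d_{i_4+1}\ge 0$, $R^-=\{i_3,\ldots,i_4\}$. A-step (performed if $|R^+|\le|R^-|$): let $j$ be the largest element of $J$ with $c_j\in R^+$ and $s=c_j-i_1+1$. If $r_{i_3+s-1}>r_{i_3+s}$, let $I=\{i_3,\ldots,i_3+s-1\}$. Otherwise let $t_1$ be minimal with $i_3\le t_1\le i_3+s-1$ and $r_{t_1}=r_{i_3+s-1}$, let $t_2\ge i_3+s$ be such that $r_{t_2}=r_{i_3+s-1}>r_{t_2+1}$, let $t_3=t_2+t_1-i_3-s+1$, and let $I=\{i_3,\ldots,t_1-1\}\cup\{t_3,\ldots,t_2\}$. The final content of column $j$ is $\{(i,j):1\le i<i_1\}\cup\{(i,j): i\in I\}$ (i.e. the points of $F_1$ in rows $i_1,\ldots,c_j$ of column $j$ are moved to the rows in $I$). B-step (performed if $|R^+|>|R^-|$): let $j$ be the smallest element of $J$ with $c_j+1\in R^-$ and $s=i_4-c_j$. If $r_{i_2-s}>r_{i_2-s+1}$, let $I=\{i_2-s+1,\ldots,i_2\}$. Otherwise let $t_1$ be maximal with $i_2-s+1\le t_1\le i_2$ and $r_{t_1}=r_{i_2-s+1}$, let $t_2\le i_2-s$ be such that $r_{t_2-1}>r_{t_2}=r_{i_2-s+1}$,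 let $t_3=t_2+s-1-(i_2-t_1)$, and let $I=\{t_2,\ldots,t_3\}\cup\{t_1+1,\ldots,i_2\}$ (so $I\subseteq R^+$, $|I|=s$, and if $i\notin I$, $i+1\in I$ then $r_i>r_{i+1}$). The final content of column $j$ is $\{(i,j):1\le i\le c_j,\ i\notin I\}\cup\{(i,j):c_j+1\le i\le i_4\}$. After an A-step or B-step in column $j$, remove $j$ from $J$ and decrease $r_i$ by $1$ for every row $i$ containing a point of the final column $j$; then continue with the new state. When the procedure stops, each column $j$ still in $J$ is given final content $\{(i,j):1\le i\le c_j\}$. The set $F_2$ is the union of the final contents of all columns $1,\ldots,n$. -}

module Defs where

open import Data.Nat as ℕ using (ℕ; zero; suc; _∸_)
open import Data.Integer as ℤ using (ℤ; +_)
open import Data.Bool using (Bool; true; false; _∧_; _∨_; not; if_then_else_)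
open import Data.Product using (Σ; _×_; _,_; ∃)
open import Data.Sum using (_⊎_)
open import Relation.Binary.PropositionalEquality using (_≡_)
open import Relation.Nullary using (¬_)

-- Row and column indices are natural numbers, 1-based.
-- Sequences (row sums, column sums) are functions ℕ → ℤ of which only
-- the entries 1..m (resp. 1..n) are relevant.  Subsets of ℤ² that occur
-- are given by Boolean indicator functions  F i j  (i = row, j = column).

inRange : ℕ → ℕ → ℕ → Bool
inRange a b i = (a ℕ.≤ᵇ i) ∧ (i ℕ.≤ᵇ b)

count : (ℕ → Bool) → ℕ → ℕ
count p zero    = zero
count p (suc N) = count p N ℕ.+ (if p (suc N) then 1 else 0)

rowSum : (ℕ → ℕ → Bool) → ℕ → ℕ → ℕ
rowSum F n i = count (λ j → F i j) n

colSum : (ℕ → ℕ → Bool) → ℕ → ℕ → ℕ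
colSum F m j = count (λ i → F i j) m

HasSums : ℕ → ℕ → (ℕ → ℤ) → (ℕ → ℤ) → (ℕ → ℕ → Bool) → Set
HasSums m n r c F =
    (∀ i j → F i j ≡ true → (1 ℕ.≤ i × i ℕ.≤ m) × (1 ℕ.≤ j × j ℕ.≤ n))
  × (∀ i → 1 ℕ.≤ i → i ℕ.≤ m → + rowSum F n i ≡ r i)
  × (∀ j → 1 ℕ.≤ j → j ℕ.≤ n → + colSum F m j ≡ c j)

Consistent : ℕ → ℕ → (ℕ → ℤ) → (ℕ → ℤ) → Set
Consistent m n r c = Σ (ℕ → ℕ → Bool) (λ F → HasSums m n r c F)

IsMin : (ℕ → Set) → ℕ → Set
IsMin P k = P k × (∀ k' → k' ℕ.< k → ¬ P k')

record State : Set where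
  constructor st
  field
    J    : ℕ → Bool          -- remaining columns
    rows : ℕ → ℤ             -- current row sums (entries 1..m relevant)
    cont : ℕ → ℕ → Bool      -- cont j i : final content of a deleted column j
open State public

module Procedure (m n : ℕ) (c : ℕ → ℤ) where

  reaches : ℕ → ℕ → Bool
  reaches j i = + i ℤ.≤ᵇ c j

  b : State → ℕ → ℤ
  b s i = + count (λ j → J s j ∧ reaches j i) n

  rr : State → ℕ → ℤ
  rr s i = if inRange 1 m i then rows s i else + 0

  -- d_i = b_i - r_i for 1 ≤ i ≤ m, d_i = 0 otherwise (in particular d_{m+1} = 0)
  d : State → ℕ → ℤ
  d s i = if inRange 1 m i then b s i ℤ.- rows s i else + 0

  Stopped : State → Set
  Stopped s = ∀ i → 1 ℕ.≤ i → i ℕ.≤ m → d s i ≡ + 0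

  -- the data R⁺ = {i1..i2}, R⁻ = {i3..i4}
  record Ranges (s : State) : Set where
    field
      i1 i2 i3 i4 : ℕ
      i1-min : IsMin (λ i → d s i ℤ.> + 0) i1
      i2-min : IsMin (λ i → d s i ℤ.> + 0 × d s (suc i) ℤ.≤ + 0) i2
      i3-min : IsMin (λ i → d s i ℤ.< + 0) i3
      i4-min : IsMin (λ i → d s i ℤ.< + 0 × d s (suc i) ℤ.≥ + 0) i4

  fix : State → ℕ → (ℕ → Bool) → State
  fix s j col = st
    (λ k → J s k ∧ not (k ℕ.≡ᵇ j))
    (λ i → rows s i ℤ.- (if col i then + 1 else + 0))
    (λ k → if k ℕ.≡ᵇ j then col else cont s k)

  -- A-step: set I of rows receiving the moved points
  data AIndex (s : State) (i3 sA : ℕ) : (ℕ → Bool) → Set where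
    a-simple : rr s (i3 ℕ.+ sA ∸ 1) ℤ.> rr s (i3 ℕ.+ sA) →
               AIndex s i3 sA (inRange i3 (i3 ℕ.+ sA ∸ 1))
    a-split  : ¬ (rr s (i3 ℕ.+ sA ∸ 1) ℤ.> rr s (i3 ℕ.+ sA)) →
               (t1 t2 : ℕ) →
               IsMin (λ t → (i3 ℕ.≤ t × t ℕ.≤ i3 ℕ.+ sA ∸ 1)
                            × rr s t ≡ rr s (i3 ℕ.+ sA ∸ 1)) t1 →
               i3 ℕ.+ sA ℕ.≤ t2 →
               rr s t2 ≡ rr s (i3 ℕ.+ sA ∸ 1) →
               rr s t2 ℤ.> rr s (suc t2) →
               AIndex s i3 sA
                 (λ i → inRange i3 (t1 ∸ 1) i
                        ∨ inRange (t2 ℕ.+ t1 ℕ.+ 1 ∸ (i3 ℕ.+ sA)) t2 i)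
  -- {i3,…,t1-1} ∪ {t3,…,t2} with t3 = t2 + t1 - i3 - s + 1
  -- (here t1 ≥ i3 ≥ 1, so t1 ∸ 1 is the true predecessor)

  -- B-step: set I ⊆ R⁺ of rows whose points are removed from column j
  data BIndex (s : State) (i2 sB : ℕ) : (ℕ → Bool) → Set where
    b-simple : rr s (i2 ∸ sB) ℤ.> rr s (suc (i2 ∸ sB)) →
               BIndex s i2 sB (inRange (suc (i2 ∸ sB)) i2)
    b-split  : ¬ (rr s (i2 ∸ sB) ℤ.> rr s (suc (i2 ∸ sB))) →
               (t1 t2 : ℕ) →
               ((suc (i2 ∸ sB) ℕ.≤ t1 × t1 ℕ.≤ i2)
                  × rr s t1 ≡ rr s (suc (i2 ∸ sB))) →
               (∀ t → t1 ℕ.< t → t ℕ.≤ i2 → ¬ (rr s t ≡ rr s (suc (i2 ∸ sB)))) →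
               -- t2 ≤ i2-s with r_{t2-1} > r_{t2} = r_{i2-s+1}
               -- (r_0 is read as +∞, i.e. t2 = 1 is allowed)
               1 ℕ.≤ t2 → t2 ℕ.≤ i2 ∸ sB →
               rr s t2 ≡ rr s (suc (i2 ∸ sB)) →
               (t2 ≡ 1 ⊎ (rr s (t2 ∸ 1) ℤ.> rr s t2)) →
               BIndex s i2 sB
                 (λ i → inRange t2 (t2 ℕ.+ sB ℕ.+ t1 ∸ suc i2) i
                        ∨ inRange (suc t1) i2 i)

  Cand : State → ℤ → ℕ → ℕ → ℕ → Set
  Cand s off lo hi j =
    (1 ℕ.≤ j × j ℕ.≤ n) × J s j ≡ true
    × (+ lo ℤ.≤ c j ℤ.+ off × c j ℤ.+ off ℤ.≤ + hi)

  data Step (s : State) : State → Set where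
    stepA : (R : Ranges s) → let open Ranges R in
            i2 ∸ i1 ℕ.≤ i4 ∸ i3 →
            (j : ℕ) →
            Cand s (+ 0) i1 i2 j →
            (∀ j' → j ℕ.< j' → ¬ Cand s (+ 0) i1 i2 j') →
            (I : ℕ → Bool) →
            AIndex s i3 (ℤ.∣ c j ℤ.- + i1 ∣ ℕ.+ 1) I →
            Step s (fix s j (λ i → inRange 1 (i1 ∸ 1) i ∨ I i))
    stepB : (R : Ranges s) → let open Ranges R in
            i4 ∸ i3 ℕ.< i2 ∸ i1 →
            (j : ℕ) →
            Cand s (+ 1) i3 i4 j →
            (∀ j' → j' ℕ.< j → ¬ Cand s (+ 1) i3 i4 j') →
            (I : ℕ → Bool) →
            BIndex s i2 ℤ.∣ + i4 ℤ.- c j ∣ I →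
            Step s (fix s j (λ i → ((1 ℕ.≤ᵇ i) ∧ (+ i ℤ.≤ᵇ c j) ∧ not (I i))
                                   ∨ ((c j ℤ.+ + 1 ℤ.≤ᵇ + i) ∧ (i ℕ.≤ᵇ i4))))

  init : (ℕ → ℤ) → State
  init r = st (inRange 1 n) r (λ _ _ → false)

  data Run (s0 : State) : ℕ → State → Set where
    done : Run s0 0 s0
    next : ∀ {k s s'} → Run s0 k s → Step s s' → Run s0 (suc k) s'

  F₂ : State → ℕ → ℕ → Bool
  F₂ s i j = if J s j then (1 ℕ.≤ᵇ i) ∧ reaches j i else cont s j i

-- Write d_i = b_i − r_i for the current state (b_i counting the remaining columns of height ≥ i).  Along a run
-- the current row sums stay nonincreasing and d has nonnegative prefix sums with total 0, which for the
-- remaining columns is the Gale–Ryser condition.  Initially the k-th prefix sum of d is the number of points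
-- of F₁ minus the number of points of F in the first k rows, hence ≥ 0 and = 0 for k = m.  An A-step or B-step
-- changes d by −1 on rows where d > 0 and by +1 on later rows where d < 0, so d stays nonnegative up to R⁻ and
-- nonpositive on it with the same total, which keeps the prefix sums nonnegative; the index sets are chosen
-- so that the column ends just before strict drops of the row sums, which keeps them nonincreasing.  While
-- some d_i ≠ 0 both R⁺ and R⁻ exist, and the drops of b after i2 and before i3 provide columns of height i2
-- and i3 − 1, so a step is possible.  Each step removes a column, so there are at most n steps, and when d = 0
-- the remaining columns filled from the top realise exactly the remaining row sums.

module Submission where

open import Defs
open import Data.Nat using (ℕ; suc; _≤_; _<_)
open import Data.Integer using (ℤ; +_) renaming (_≤_ to _≤ℤ_)
open import Data.Product using (Σ; _×_; ∃)
open import Data.Sum using (_⊎_)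
open import Relation.Binary.PropositionalEquality using (_≡_)

open import Data.Bool using (Bool; true; false; _∧_; _∨_; not; if_then_else_; T)
import Data.Bool.Properties as Boolₚ
open import Data.Empty using (⊥)
import Data.Integer as ℤ
import Data.Integer.Properties as ℤₚ
open import Data.Integer.Tactic.RingSolver using (solve-∀)
open import Data.Nat as ℕ using (zero; _+_; _∸_; z≤n; s≤s; _≤ᵇ_; _≡ᵇ_)
open import Data.Nat.Induction using (<-rec)
import Data.Nat.Properties as ℕₚ
import Data.Nat.Tactic.RingSolver as ℕ-Solver
open import Data.Product using (_,_; proj₁; proj₂)
open import Data.Sum using (inj₁; inj₂; [_,_]′)
open import Function using (case_of_)
open import Function.Bundles using (Equivalence)
open import Relation.Binary.PropositionalEquality
  using (_≢_; ≢-sym; refl; sym; trans; cong; cong₂; subst; subst₂; module ≡-Reasoning)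
open import Relation.Nullary using (¬_; Dec; yes; no; contradiction)
open import Relation.Nullary.Decidable using (_×-dec_)
open import Algebra.Properties.CommutativeSemigroup ℕₚ.+-commutativeSemigroup
  using () renaming (interchange to +-interchange; xy∙z≈xz∙y to +-swapʳ)
open import Algebra.Properties.CommutativeSemigroup ℤₚ.+-commutativeSemigroup
  using () renaming (interchange to ℤ-interchange)

ind : Bool → ℕ
ind b = if b then 1 else 0

T⇒≡true : ∀ {b} → T b → b ≡ true
T⇒≡true = Equivalence.to Boolₚ.T-≡

≡true⇒T : ∀ {b} → b ≡ true → T b
≡true⇒T = Equivalence.from Boolₚ.T-≡

true≢false : true ≢ false
true≢false ()

≤⇒≤ᵇ≡true : ∀ {a b} → a ≤ b → (a ≤ᵇ b) ≡ true
≤⇒≤ᵇ≡true a≤b = T⇒≡true (ℕₚ.≤⇒≤ᵇ a≤b)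

≤ᵇ≡true⇒≤ : ∀ a b → (a ≤ᵇ b) ≡ true → a ≤ b
≤ᵇ≡true⇒≤ a b e = ℕₚ.≤ᵇ⇒≤ a b (≡true⇒T e)

≤ᵇ≡false⇒> : ∀ a b → (a ≤ᵇ b) ≡ false → b < a
≤ᵇ≡false⇒> a b e = ℕₚ.≰⇒> λ a≤b → true≢false (trans (sym (≤⇒≤ᵇ≡true a≤b)) e)

>⇒≤ᵇ≡false : ∀ {a b} → b < a → (a ≤ᵇ b) ≡ false
>⇒≤ᵇ≡false {a} {b} b<a with a ≤ᵇ b in e
... | false = refl
... | true  = contradiction (≤ᵇ≡true⇒≤ a b e) (ℕₚ.<⇒≱ b<a)

≡ᵇ-refl : ∀ a → (a ≡ᵇ a) ≡ true
≡ᵇ-refl a = T⇒≡true (ℕₚ.≡⇒≡ᵇ a a refl)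

≢⇒≡ᵇ≡false : ∀ a b → a ≢ b → (a ≡ᵇ b) ≡ false
≢⇒≡ᵇ≡false a b a≢b with a ≡ᵇ b in e
... | false = refl
... | true  = contradiction (ℕₚ.≡ᵇ⇒≡ a b (≡true⇒T e)) a≢b

≡ᵇ≡true⇒≡ : ∀ a b → (a ≡ᵇ b) ≡ true → a ≡ b
≡ᵇ≡true⇒≡ a b e = ℕₚ.≡ᵇ⇒≡ a b (≡true⇒T e)

suc[n∸1]≡n : ∀ {n} → 1 ≤ n → suc (n ∸ 1) ≡ n
suc[n∸1]≡n {suc n} _ = refl

inRange-intro : ∀ {a b i} → a ≤ i → i ≤ b → inRange a b i ≡ true
inRange-intro a≤i i≤b rewrite ≤⇒≤ᵇ≡true a≤i | ≤⇒≤ᵇ≡true i≤b = refl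

inRange-elim : ∀ a b i → inRange a b i ≡ true → a ≤ i × i ≤ b
inRange-elim a b i e with a ≤ᵇ i in e₁ | i ≤ᵇ b in e₂
... | true | true = ≤ᵇ≡true⇒≤ a i e₁ , ≤ᵇ≡true⇒≤ i b e₂

inRange-below : ∀ {a b i} → i < a → inRange a b i ≡ false
inRange-below i<a rewrite >⇒≤ᵇ≡false i<a = refl

inRange-above : ∀ a {b i} → b < i → inRange a b i ≡ false
inRange-above a b<i rewrite >⇒≤ᵇ≡false b<i = Boolₚ.∧-zeroʳ _

inRange-last : ∀ a b i → inRange a b i ≡ true → inRange a b (suc i) ≡ false → i ≡ b
inRange-last a b i e₁ e₂ with inRange-elim a b i e₁
... | a≤i , i≤b with suc i ℕ.≤? b
...   | yes i<b = contradiction (inRange-intro (ℕₚ.m≤n⇒m≤1+n a≤i) i<b) (λ e → true≢false (trans (sym e) e₂))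
...   | no  i≮b = ℕₚ.≤-antisym i≤b (ℕₚ.≤-pred (ℕₚ.≰⇒> i≮b))

inRange-first : ∀ a b i → inRange a b i ≡ false → inRange a b (suc i) ≡ true → suc i ≡ a
inRange-first a b i e₁ e₂ with inRange-elim a b (suc i) e₂
... | a≤1+i , 1+i≤b with a ℕ.≤? i
...   | yes a≤i = contradiction (inRange-intro a≤i (ℕₚ.≤-trans (ℕₚ.n≤1+n i) 1+i≤b)) (λ e → true≢false (trans (sym e) e₁))
...   | no  a≰i = ℕₚ.≤-antisym (ℕₚ.≰⇒> a≰i) a≤1+i

∨-false-l : ∀ {x y} → (x ∨ y) ≡ false → x ≡ false
∨-false-l {false} _ = refl

∨-false-r : ∀ {x y} → (x ∨ y) ≡ false → y ≡ false
∨-false-r {false} e = e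

∨-true-l : ∀ {x y} → x ≡ true → (x ∨ y) ≡ true
∨-true-l refl = refl

∨-true-r : ∀ {x y} → y ≡ true → (x ∨ y) ≡ true
∨-true-r {x} refl = Boolₚ.∨-zeroʳ x

∧-true-l : ∀ {x y} → (x ∧ y) ≡ true → x ≡ true
∧-true-l {true} _ = refl

count-cong : ∀ {p q : ℕ → Bool} N → (∀ i → 1 ≤ i → i ≤ N → p i ≡ q i) → count p N ≡ count q N
count-cong zero    p≗q = refl
count-cong (suc N) p≗q = cong₂ _+_ (count-cong N (λ i 1≤i i≤N → p≗q i 1≤i (ℕₚ.m≤n⇒m≤1+n i≤N)))
                                   (cong ind (p≗q (suc N) (s≤s z≤n) ℕₚ.≤-refl))

count≤ : ∀ (p : ℕ → Bool) N → count p N ≤ N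
count≤ p zero = z≤n
count≤ p (suc N) with p (suc N)
... | true  = ℕₚ.≤-trans (ℕₚ.≤-reflexive (ℕₚ.+-comm (count p N) 1)) (s≤s (count≤ p N))
... | false = ℕₚ.≤-trans (ℕₚ.≤-reflexive (ℕₚ.+-identityʳ _)) (ℕₚ.m≤n⇒m≤1+n (count≤ p N))

count-mono : ∀ {p q : ℕ → Bool} N → (∀ i → p i ≡ true → q i ≡ true) → count p N ≤ count q N
count-mono zero p⇒q = z≤n
count-mono {p} (suc N) p⇒q with p (suc N) in e
... | true rewrite p⇒q (suc N) e = ℕₚ.+-monoˡ-≤ 1 (count-mono N p⇒q)
... | false = ℕₚ.+-mono-≤ (count-mono N p⇒q) z≤n

count-monoʳ : ∀ (p : ℕ → Bool) {K N} → K ≤ N → count p K ≤ count p N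
count-monoʳ p {K} {N} K≤N with ℕₚ.m≤n⇒m<n∨m≡n K≤N
... | inj₂ refl = ℕₚ.≤-refl
... | inj₁ K<N with N
...   | suc N′ = ℕₚ.≤-trans (count-monoʳ p (ℕₚ.≤-pred K<N)) (ℕₚ.m≤m+n (count p N′) _)

count-none : ∀ {p : ℕ → Bool} N → (∀ i → 1 ≤ i → i ≤ N → p i ≡ false) → count p N ≡ 0
count-none zero    none = refl
count-none (suc N) none rewrite none (suc N) (s≤s z≤n) ℕₚ.≤-refl =
  trans (ℕₚ.+-identityʳ _) (count-none N (λ i 1≤i i≤N → none i 1≤i (ℕₚ.m≤n⇒m≤1+n i≤N)))

count-all : ∀ N → count (λ _ → true) N ≡ N
count-all zero = refl
count-all (suc N) rewrite count-all N = ℕₚ.+-comm N 1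

count-truncate : ∀ {p : ℕ → Bool} K N → K ≤ N → (∀ i → K < i → i ≤ N → p i ≡ false) →
                 count p N ≡ count p K
count-truncate K zero z≤n none = refl
count-truncate {p} K (suc N) K≤1+N none with ℕₚ.m≤n⇒m<n∨m≡n K≤1+N
... | inj₂ refl = refl
... | inj₁ K<1+N rewrite none (suc N) K<1+N ℕₚ.≤-refl =
  trans (ℕₚ.+-identityʳ _)
        (count-truncate K N (ℕₚ.≤-pred K<1+N) (λ i K<i i≤N → none i K<i (ℕₚ.m≤n⇒m≤1+n i≤N)))

count-pointwise-+ : ∀ (f g h k : ℕ → Bool) N → (∀ i → ind (f i) + ind (g i) ≡ ind (h i) + ind (k i)) →
                    count f N + count g N ≡ count h N + count k N
count-pointwise-+ f g h k zero    _  = refl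
count-pointwise-+ f g h k (suc N) eq =
  trans (+-interchange (count f N) (ind (f (suc N))) (count g N) (ind (g (suc N))))
  (trans (cong₂ _+_ (count-pointwise-+ f g h k N eq) (eq (suc N)))
         (+-interchange (count h N) (count k N) (ind (h (suc N))) (ind (k (suc N)))))

count-∨-disjoint : ∀ (p q : ℕ → Bool) N → (∀ i → p i ≡ true → q i ≡ false) →
                   count (λ i → p i ∨ q i) N ≡ count p N + count q N
count-∨-disjoint p q N disjoint =
  trans (sym (trans (cong (λ z → count (λ i → p i ∨ q i) N + z) (count-none N λ _ _ _ → refl)) (ℕₚ.+-identityʳ _)))
        (count-pointwise-+ (λ i → p i ∨ q i) (λ _ → false) p q N pointwise)
  where
  pointwise : ∀ i → ind (p i ∨ q i) + 0 ≡ ind (p i) + ind (q i)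
  pointwise i with p i in e
  ... | true rewrite disjoint i e = refl
  ... | false = ℕₚ.+-identityʳ _

count-update : ∀ (f g : ℕ → Bool) j N → 1 ≤ j → j ≤ N → (∀ i → i ≢ j → f i ≡ g i) →
               count f N + ind (g j) ≡ count g N + ind (f j)
count-update f g j zero 1≤j j≤0 _ = contradiction j≤0 (ℕₚ.<⇒≱ 1≤j)
count-update f g j (suc N) 1≤j j≤1+N f≗g with ℕₚ.m≤n⇒m<n∨m≡n j≤1+N
... | inj₂ refl rewrite count-cong {f} {g} N (λ i _ i≤N → f≗g i (ℕₚ.<⇒≢ (s≤s i≤N))) =
  +-swapʳ (count g N) (ind (f (suc N))) (ind (g (suc N)))
... | inj₁ j<1+N rewrite f≗g (suc N) (λ e → ℕₚ.<⇒≢ j<1+N (sym e)) =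
  trans (+-swapʳ (count f N) (ind (g (suc N))) (ind (g j)))
  (trans (cong (_+ ind (g (suc N))) (count-update f g j N 1≤j (ℕₚ.≤-pred j<1+N) f≗g))
         (+-swapʳ (count g N) (ind (f j)) (ind (g (suc N)))))

count-insert : ∀ (f g : ℕ → Bool) j N → 1 ≤ j → j ≤ N → (∀ i → i ≢ j → f i ≡ g i) → g j ≡ false →
               count f N ≡ count g N + ind (f j)
count-insert f g j N 1≤j j≤N f≗g gj≡false =
  trans (sym (ℕₚ.+-identityʳ _))
        (trans (cong (λ b → count f N + ind b) (sym gj≡false)) (count-update f g j N 1≤j j≤N f≗g))

count-witness : ∀ (p q : ℕ → Bool) N → (∀ i → q i ≡ true → p i ≡ true) → count q N < count p N →
                ∃ λ j → (1 ≤ j × j ≤ N) × p j ≡ true × q j ≡ false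
count-witness p q (suc N) q⇒p q<p with p (suc N) in ep | q (suc N) in eq
... | true  | false = suc N , (s≤s z≤n , ℕₚ.≤-refl) , ep , eq
... | false | true  = contradiction (trans (sym (q⇒p (suc N) eq)) ep) true≢false
... | true  | true  = widen (count-witness p q N q⇒p (ℕₚ.+-cancelʳ-< 1 _ _ q<p))
  where widen : _ → _
        widen (j , (1≤j , j≤N) , pj , qj) = j , (1≤j , ℕₚ.m≤n⇒m≤1+n j≤N) , pj , qj
... | false | false = widen (count-witness p q N q⇒p (ℕₚ.+-cancelʳ-< 0 _ _ q<p))
  where widen : _ → _
        widen (j , (1≤j , j≤N) , pj , qj) = j , (1≤j , ℕₚ.m≤n⇒m≤1+n j≤N) , pj , qj

count-interval-prefix : ∀ a b → 1 ≤ a → count (inRange a b) b ≡ suc b ∸ a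
count-interval-prefix (suc a) zero    _   = sym (ℕₚ.0∸n≡0 a)
count-interval-prefix a       (suc b) 1≤a =
  trans (cong (_+ ind (inRange a (suc b) (suc b)))
              (trans (count-cong b (λ i _ i≤b → cong ((a ≤ᵇ i) ∧_)
                        (trans (≤⇒≤ᵇ≡true (ℕₚ.m≤n⇒m≤1+n i≤b)) (sym (≤⇒≤ᵇ≡true i≤b)))))
                     (count-interval-prefix a b 1≤a)))
        last
  where
  last : (suc b ∸ a) + ind (inRange a (suc b) (suc b)) ≡ suc (suc b) ∸ a
  last with a ≤ᵇ suc b in e
  ... | true rewrite ≤⇒≤ᵇ≡true (ℕₚ.≤-refl {suc b}) =
    trans (ℕₚ.+-comm _ 1) (sym (ℕₚ.+-∸-assoc 1 (≤ᵇ≡true⇒≤ a (suc b) e)))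
  ... | false = trans (ℕₚ.+-identityʳ _)
                      (trans (ℕₚ.m≤n⇒m∸n≡0 (ℕₚ.<⇒≤ (≤ᵇ≡false⇒> a (suc b) e)))
                             (sym (ℕₚ.m≤n⇒m∸n≡0 (≤ᵇ≡false⇒> a (suc b) e))))

count-interval : ∀ a b N → 1 ≤ a → b ≤ N → count (inRange a b) N ≡ suc b ∸ a
count-interval a b N 1≤a b≤N =
  trans (count-truncate b N b≤N (λ i b<i _ → inRange-above a b<i)) (count-interval-prefix a b 1≤a)

count-interval-length : ∀ a b len N → 1 ≤ a → a + len ≡ suc b → b ≤ N → count (inRange a b) N ≡ len
count-interval-length a b len N 1≤a a+len≡1+b b≤N =
  trans (count-interval a b N 1≤a b≤N) (trans (cong (_∸ a) (sym a+len≡1+b)) (ℕₚ.m+n∸m≡n a len))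

count-≤ᵇ : ∀ h m → h ≤ m → count (λ i → i ≤ᵇ h) m ≡ h
count-≤ᵇ h m h≤m =
  trans (count-cong m (λ i 1≤i _ → cong (_∧ (i ≤ᵇ h)) (sym (≤⇒≤ᵇ≡true 1≤i)))) (count-interval 1 h m (s≤s z≤n) h≤m)

count-two-intervals : ∀ a x y b N → 1 ≤ a → x < y → x ≤ N → b ≤ N →
                      count (λ i → inRange a x i ∨ inRange y b i) N ≡ (suc x ∸ a) + (suc b ∸ y)
count-two-intervals a x y b N 1≤a x<y x≤N b≤N =
  trans (count-∨-disjoint (inRange a x) (inRange y b) N
          (λ i e → inRange-below (ℕₚ.≤-<-trans (proj₂ (inRange-elim a x i e)) x<y)))
        (cong₂ _+_ (count-interval a x N 1≤a x≤N) (count-interval y b N (ℕₚ.≤-trans (s≤s z≤n) x<y) b≤N))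

[n∸1]+[h∸n+1]≡h : ∀ n h → 1 ≤ n → n ≤ h → (n ∸ 1) + ((h ∸ n) + 1) ≡ h
[n∸1]+[h∸n+1]≡h (suc n) h _ n<h =
  trans (cong (λ x → n + x) (ℕₚ.+-comm (h ∸ suc n) 1)) (trans (ℕₚ.+-suc n (h ∸ suc n)) (ℕₚ.m+[n∸m]≡n n<h))

-- The A-split index set is {i3 , … , t1 − 1} ∪ {t3 , … , t2} with t3 = t2 + t1 + 1 − W; writing
-- t1 = i3 + v, W = t1 + 1 + q and t2 = W + w gives t3 = t1 + 1 + w.
a-split-arith : ∀ i3 t1 W t2 v q w → 1 ≤ i3 → i3 + v ≡ t1 → suc t1 + q ≡ W → W + w ≡ t2 →
                t1 < t2 + t1 + 1 ∸ W × (suc (t1 ∸ 1) ∸ i3) + (suc t2 ∸ (t2 + t1 + 1 ∸ W)) ≡ W ∸ i3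
a-split-arith (suc i) _ _ _ v q w _ refl refl refl =
  subst (t1 <_) (sym t3≡) (s≤s (ℕₚ.m≤n+m t1 w)) ,
  (begin
    (t1 ∸ suc i) + (suc t2 ∸ (t2 + t1 + 1 ∸ W))  ≡⟨ cong₂ _+_ (ℕₚ.m+n∸m≡n (suc i) v) (cong (suc t2 ∸_) t3≡) ⟩
    v + (t2 ∸ (w + t1))                          ≡⟨ cong (λ x → v + (x ∸ (w + t1))) (t2-split (suc i) v q w) ⟩
    v + ((w + t1) + suc q ∸ (w + t1))            ≡⟨ cong (λ x → v + x) (ℕₚ.m+n∸m≡n (w + t1) (suc q)) ⟩
    v + suc q                                    ≡⟨ ℕₚ.m+n∸m≡n (suc i) (v + suc q) ⟨
    (suc i + (v + suc q)) ∸ suc i                ≡⟨ cong (_∸ suc i) (W-split i v q) ⟩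
    W ∸ suc i                                    ∎)
  where
  open ≡-Reasoning
  t1 W t2 : ℕ
  t1 = suc i + v
  W  = suc t1 + q
  t2 = W + w
  reassoc : ∀ a b c → a + b + c + 1 ≡ a + suc (b + c)
  reassoc = ℕ-Solver.solve-∀
  t2-split : ∀ i′ v q w → suc (i′ + v) + q + w ≡ w + (i′ + v) + suc q
  t2-split = ℕ-Solver.solve-∀
  W-split : ∀ i v q → suc i + (v + suc q) ≡ suc (suc i + v) + q
  W-split = ℕ-Solver.solve-∀
  t3≡ : t2 + t1 + 1 ∸ W ≡ suc (w + t1)
  t3≡ = trans (cong (_∸ W) (reassoc W w t1)) (ℕₚ.m+n∸m≡n W (suc (w + t1)))

-- The B-split index set is {t2 , … , t3} ∪ {t1 + 1 , … , i2} with t3 = t2 + s + t1 − (i2 + 1); writing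
-- p0 = i2 − s = t2 + w, t1 = p0 + 1 + v and i2 = t1 + q gives s = v + 1 + q and t3 = t2 + v.
b-split-arith : ∀ t2 p0 t1 i2 sB w v q → t2 + w ≡ p0 → suc p0 + v ≡ t1 → t1 + q ≡ i2 → p0 + sB ≡ i2 →
                t2 + sB + t1 ∸ suc i2 < t1 × (suc (t2 + sB + t1 ∸ suc i2) ∸ t2) + (i2 ∸ t1) ≡ sB
b-split-arith t2 _ _ _ sB w v q refl refl refl p0+sB≡i2 with sB≡ p0+sB≡i2
  where
  sB≡ : t2 + w + sB ≡ suc (t2 + w) + v + q → sB ≡ suc v + q
  sB≡ e = ℕₚ.+-cancelˡ-≡ (t2 + w) sB (suc v + q) (trans e (regroup (t2 + w) v q))
    where
    regroup : ∀ p v q → suc p + v + q ≡ p + (suc v + q)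
    regroup = ℕ-Solver.solve-∀
... | refl =
  subst (_< t1) (sym t3≡) (s≤s (ℕₚ.+-monoˡ-≤ v (ℕₚ.m≤m+n t2 w))) ,
  cong₂ _+_ (trans (cong (λ x → suc x ∸ t2) t3≡) (trans (cong (_∸ t2) (sym (ℕₚ.+-suc t2 v))) (ℕₚ.m+n∸m≡n t2 (suc v))))
            (ℕₚ.m+n∸m≡n t1 q)
  where
  t1 : ℕ
  t1 = suc (t2 + w) + v
  reassoc : ∀ t2 v q t1 → t2 + (suc v + q) + t1 ≡ t2 + v + suc (t1 + q)
  reassoc = ℕ-Solver.solve-∀
  t3≡ : t2 + (suc v + q) + t1 ∸ suc (t1 + q) ≡ t2 + v
  t3≡ = trans (cong (_∸ suc (t1 + q)) (reassoc t2 v q t1)) (ℕₚ.m+n∸n≡m (t2 + v) (suc (t1 + q)))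

module _ {P : ℕ → Set} (P? : ∀ k → Dec (P k)) where

  minimal : ∀ w → P w → ∃ (IsMin P)
  minimal = <-rec (λ w → P w → ∃ (IsMin P)) search
    where
    search : ∀ w → (∀ {v} → v < w → P v → ∃ (IsMin P)) → P w → ∃ (IsMin P)
    search w below pw with ℕₚ.anyUpTo? P? w
    ... | yes (v , v<w , pv) = below v<w pv
    ... | no  none           = w , pw , λ v v<w pv → none (v , v<w , pv)

  greatest : ∀ N w → w ≤ N → P w → ∃ λ k → P k × k ≤ N × (∀ k′ → k < k′ → k′ ≤ N → ¬ P k′)
  greatest zero    .zero z≤n pw = 0 , pw , z≤n , λ k′ 0<k′ k′≤0 → contradiction k′≤0 (ℕₚ.<⇒≱ 0<k′)
  greatest (suc N) w   w≤1+N pw with P? (suc N)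
  ... | yes p = suc N , p , ℕₚ.≤-refl , λ k′ k<k′ k′≤ → contradiction k′≤ (ℕₚ.<⇒≱ k<k′)
  ... | no ¬p with ℕₚ.m≤n⇒m<n∨m≡n w≤1+N
  ...   | inj₂ refl = contradiction pw ¬p
  ...   | inj₁ w<1+N with greatest N w (ℕₚ.≤-pred w<1+N) pw
  ...     | k , pk , k≤N , none = k , pk , ℕₚ.m≤n⇒m≤1+n k≤N , none′
    where
    none′ : ∀ k′ → k < k′ → k′ ≤ suc N → ¬ P k′
    none′ k′ k<k′ k′≤1+N with ℕₚ.m≤n⇒m<n∨m≡n k′≤1+N
    ... | inj₁ k′<1+N = none k′ k<k′ (ℕₚ.≤-pred k′<1+N)
    ... | inj₂ refl   = ¬p

  lastOfRun : ∀ N → (∀ k → P k → k ≤ N) → ∀ w → P w → ∃ λ k → P k × ¬ P (suc k)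
  lastOfRun N bounded w pw with greatest N w (bounded w pw) pw
  ... | k , pk , _ , none = k , pk , λ p[1+k] → none (suc k) (ℕₚ.n<1+n k) (bounded (suc k) p[1+k]) p[1+k]

induction-on-interval : ∀ {P : ℕ → Set} {a e} → P a → (∀ i → a ≤ i → i < e → P i → P (suc i)) →
                        ∀ i → a ≤ i → i ≤ e → P i
induction-on-interval pa step i a≤i i≤e with ℕₚ.m≤n⇒m<n∨m≡n a≤i
... | inj₂ refl = pa
... | inj₁ a<i with i
...   | suc i′ = step i′ (ℕₚ.≤-pred a<i) i≤e
                  (induction-on-interval pa step i′ (ℕₚ.≤-pred a<i) (ℕₚ.≤-trans (ℕₚ.n≤1+n i′) i≤e))

prefixSum : (ℕ → ℤ) → ℕ → ℤ
prefixSum f zero    = + 0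
prefixSum f (suc k) = prefixSum f k ℤ.+ f (suc k)

prefixSum-cong : ∀ {f g : ℕ → ℤ} k → (∀ i → 1 ≤ i → i ≤ k → f i ≡ g i) → prefixSum f k ≡ prefixSum g k
prefixSum-cong zero    f≗g = refl
prefixSum-cong (suc k) f≗g = cong₂ ℤ._+_ (prefixSum-cong k (λ i 1≤i i≤k → f≗g i 1≤i (ℕₚ.m≤n⇒m≤1+n i≤k)))
                                         (f≗g (suc k) (s≤s z≤n) ℕₚ.≤-refl)

prefixSum-ind : ∀ (p : ℕ → Bool) k → prefixSum (λ i → + ind (p i)) k ≡ + count p k
prefixSum-ind p zero = refl
prefixSum-ind p (suc k) rewrite prefixSum-ind p k with p (suc k)
... | true  = refl
... | false = refl

prefixSum-+ : ∀ (f g : ℕ → ℤ) k → prefixSum (λ i → f i ℤ.+ g i) k ≡ prefixSum f k ℤ.+ prefixSum g k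
prefixSum-+ f g zero = refl
prefixSum-+ f g (suc k) rewrite prefixSum-+ f g k =
  ℤ-interchange (prefixSum f k) (prefixSum g k) (f (suc k)) (g (suc k))

prefixSum-- : ∀ (f g : ℕ → ℤ) k → prefixSum (λ i → f i ℤ.- g i) k ≡ prefixSum f k ℤ.- prefixSum g k
prefixSum-- f g zero = refl
prefixSum-- f g (suc k) rewrite prefixSum-- f g k =
  regroup (prefixSum f k) (prefixSum g k) (f (suc k)) (g (suc k))
  where
  regroup : ∀ a b x y → a ℤ.- b ℤ.+ (x ℤ.- y) ≡ a ℤ.+ x ℤ.- (b ℤ.+ y)
  regroup = solve-∀

sumℕ : (ℕ → ℕ) → ℕ → ℕ
sumℕ f zero    = 0
sumℕ f (suc k) = sumℕ f k + f (suc k)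

sumℕ-+ : ∀ (f g : ℕ → ℕ) N → sumℕ (λ j → f j + g j) N ≡ sumℕ f N + sumℕ g N
sumℕ-+ f g zero = refl
sumℕ-+ f g (suc N) rewrite sumℕ-+ f g N = +-interchange (sumℕ f N) (sumℕ g N) (f (suc N)) (g (suc N))

sumℕ-cong : ∀ {f g : ℕ → ℕ} N → (∀ j → 1 ≤ j → j ≤ N → f j ≡ g j) → sumℕ f N ≡ sumℕ g N
sumℕ-cong zero    f≗g = refl
sumℕ-cong (suc N) f≗g = cong₂ _+_ (sumℕ-cong N (λ j 1≤j j≤N → f≗g j 1≤j (ℕₚ.m≤n⇒m≤1+n j≤N)))
                                  (f≗g (suc N) (s≤s z≤n) ℕₚ.≤-refl)

sumℕ-mono : ∀ {f g : ℕ → ℕ} N → (∀ j → 1 ≤ j → j ≤ N → f j ≤ g j) → sumℕ f N ≤ sumℕ g N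
sumℕ-mono zero    f≤g = z≤n
sumℕ-mono (suc N) f≤g = ℕₚ.+-mono-≤ (sumℕ-mono N (λ j 1≤j j≤N → f≤g j 1≤j (ℕₚ.m≤n⇒m≤1+n j≤N)))
                                    (f≤g (suc N) (s≤s z≤n) ℕₚ.≤-refl)

sumℕ-zero : ∀ N → sumℕ (λ _ → 0) N ≡ 0
sumℕ-zero zero = refl
sumℕ-zero (suc N) rewrite sumℕ-zero N = refl

count≡sumℕ : ∀ (p : ℕ → Bool) N → count p N ≡ sumℕ (λ i → ind (p i)) N
count≡sumℕ p zero = refl
count≡sumℕ p (suc N) rewrite count≡sumℕ p N = refl

sumℕ-count-swap : ∀ (H : ℕ → ℕ → Bool) K N →
                  sumℕ (λ i → count (H i) N) K ≡ sumℕ (λ j → count (λ i → H i j) K) N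
sumℕ-count-swap H zero    N = sym (sumℕ-zero N)
sumℕ-count-swap H (suc K) N =
  trans (cong₂ _+_ (sumℕ-count-swap H K N) (count≡sumℕ (H (suc K)) N))
        (sym (sumℕ-+ (λ j → count (λ i → H i j) K) (λ j → ind (H (suc K) j)) N))

prefixSum-+ℕ : ∀ (f : ℕ → ℕ) k → prefixSum (λ i → + f i) k ≡ + sumℕ f k
prefixSum-+ℕ f zero = refl
prefixSum-+ℕ f (suc k) rewrite prefixSum-+ℕ f k = refl

prefixSum-nonneg-tail : ∀ (f : ℕ → ℤ) {k M} → k ≤ M → (∀ i → k < i → i ≤ M → + 0 ℤ.≤ f i) →
                        prefixSum f k ℤ.≤ prefixSum f M
prefixSum-nonneg-tail f {k} {M} k≤M nonneg with ℕₚ.m≤n⇒m<n∨m≡n k≤M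
... | inj₂ refl = ℤₚ.≤-refl
... | inj₁ k<M with M
...   | suc M′ = ℤₚ.≤-trans (prefixSum-nonneg-tail f (ℕₚ.≤-pred k<M) (λ i k<i i≤M′ → nonneg i k<i (ℕₚ.m≤n⇒m≤1+n i≤M′)))
                            (ℤₚ.≤-trans (ℤₚ.≤-reflexive (sym (ℤₚ.+-identityʳ _)))
                                        (ℤₚ.+-monoʳ-≤ (prefixSum f M′) (nonneg (suc M′) k<M ℕₚ.≤-refl)))

prefixSum-nonpos-tail : ∀ (f : ℕ → ℤ) {k M} → k ≤ M → (∀ i → k < i → i ≤ M → f i ℤ.≤ + 0) →
                        prefixSum f M ℤ.≤ prefixSum f k
prefixSum-nonpos-tail f {k} {M} k≤M nonpos with ℕₚ.m≤n⇒m<n∨m≡n k≤M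
... | inj₂ refl = ℤₚ.≤-refl
... | inj₁ k<M with M
...   | suc M′ = ℤₚ.≤-trans (ℤₚ.≤-trans (ℤₚ.+-monoʳ-≤ (prefixSum f M′) (nonpos (suc M′) k<M ℕₚ.≤-refl))
                                        (ℤₚ.≤-reflexive (ℤₚ.+-identityʳ _)))
                            (prefixSum-nonpos-tail f (ℕₚ.≤-pred k<M) (λ i k<i i≤M′ → nonpos i k<i (ℕₚ.m≤n⇒m≤1+n i≤M′)))

prefixSum-diff-stable : ∀ (f g : ℕ → ℤ) T → (∀ i → T < i → f i ≡ g i) → ∀ k → T ≤ k →
                        prefixSum f k ℤ.- prefixSum g k ≡ prefixSum f T ℤ.- prefixSum g T
prefixSum-diff-stable f g T f≗g k T≤k with ℕₚ.m≤n⇒m<n∨m≡n T≤k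
... | inj₂ refl = refl
... | inj₁ T<k with k
...   | suc k′ rewrite f≗g (suc k′) T<k =
  trans (cancel (prefixSum f k′) (prefixSum g k′) (g (suc k′)))
        (prefixSum-diff-stable f g T f≗g k′ (ℕₚ.≤-pred T<k))
  where
  cancel : ∀ a b x → a ℤ.+ x ℤ.- (b ℤ.+ x) ≡ a ℤ.- b
  cancel = solve-∀

-- Below a the prefix sums of d′ are those of d and on [a , p) they grow; on (p , T] they decrease towards
-- their value at T, which is that of d because d′ agrees with d beyond T and has the same total.
prefixSum-nonneg-redistribute :
  ∀ (d d′ : ℕ → ℤ) {m a p T} → T ≤ m →
  (∀ k → + 0 ℤ.≤ prefixSum d k) → prefixSum d′ m ≡ prefixSum d m →
  (∀ i → 1 ≤ i → i < a → d′ i ≡ d i) →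
  (∀ i → a ≤ i → i < p → + 0 ℤ.≤ d′ i) →
  (∀ i → p < i → i ≤ T → d′ i ℤ.≤ + 0) →
  (∀ i → T < i → d′ i ≡ d i) →
  ∀ k → + 0 ℤ.≤ prefixSum d′ k
prefixSum-nonneg-redistribute d d′ {m} {a} {p} {T} T≤m dom total low nonneg nonpos high k with k ℕ.<? p
... | yes k<p = before k k<p
  where
  before : ∀ k → k < p → + 0 ℤ.≤ prefixSum d′ k
  before zero    _     = ℤₚ.≤-refl
  before (suc k) 1+k<p with suc k ℕ.<? a
  ... | yes 1+k<a = subst (+ 0 ℤ.≤_) (sym (prefixSum-cong (suc k) (λ i 1≤i i≤1+k → low i 1≤i (ℕₚ.≤-<-trans i≤1+k 1+k<a))))
                          (dom (suc k))
  ... | no  1+k≮a = ℤₚ.+-mono-≤ (before k (ℕₚ.<-trans (ℕₚ.n<1+n k) 1+k<p)) (nonneg (suc k) (ℕₚ.≮⇒≥ 1+k≮a) 1+k<p)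
... | no k≮p = case k ℕ.≤? T of λ where
    (yes k≤T) → ℤₚ.≤-trans (subst (+ 0 ℤ.≤_) (sym (agree T ℕₚ.≤-refl)) (dom T))
                           (prefixSum-nonpos-tail d′ k≤T (λ i k<i i≤T → nonpos i (ℕₚ.≤-<-trans (ℕₚ.≮⇒≥ k≮p) k<i) i≤T))
    (no  k≰T) → subst (+ 0 ℤ.≤_) (sym (agree k (ℕₚ.<⇒≤ (ℕₚ.≰⇒> k≰T)))) (dom k)
  where
  agree : ∀ k → T ≤ k → prefixSum d′ k ≡ prefixSum d k
  agree k T≤k = ℤₚ.i-j≡0⇒i≡j _ _
    (trans (prefixSum-diff-stable d′ d T high k T≤k)
           (trans (sym (prefixSum-diff-stable d′ d T high m T≤m)) (ℤₚ.i≡j⇒i-j≡0 total)))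

i-j+j≡i : ∀ i j → i ℤ.- j ℤ.+ j ≡ i
i-j+j≡i = solve-∀

0<i-j⇒j<i : ∀ i j → + 0 ℤ.< i ℤ.- j → j ℤ.< i
0<i-j⇒j<i i j 0<i-j = subst₂ ℤ._<_ (ℤₚ.+-identityˡ j) (i-j+j≡i i j) (ℤₚ.+-monoˡ-< j 0<i-j)

i-j<0⇒i<j : ∀ i j → i ℤ.- j ℤ.< + 0 → i ℤ.< j
i-j<0⇒i<j i j i-j<0 = subst₂ ℤ._<_ (i-j+j≡i i j) (ℤₚ.+-identityˡ j) (ℤₚ.+-monoˡ-< j i-j<0)

i<j⇒i+1≤j : ∀ {i j} → i ℤ.< j → i ℤ.+ + 1 ℤ.≤ j
i<j⇒i+1≤j {i} {j} i<j = subst (ℤ._≤ j) (ℤₚ.+-comm (+ 1) i) (ℤₚ.i<j⇒suc[i]≤j i<j)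

i<j⇒i≤j-1 : ∀ {i j} → i ℤ.< j → i ℤ.≤ j ℤ.- + 1
i<j⇒i≤j-1 {i} {j} i<j = subst (ℤ._≤ j ℤ.- + 1) (i+1-1≡i i) (ℤₚ.+-monoˡ-≤ (ℤ.- + 1) (i<j⇒i+1≤j i<j))
  where
  i+1-1≡i : ∀ i → i ℤ.+ + 1 ℤ.- + 1 ≡ i
  i+1-1≡i = solve-∀

ℤ≤⇒≤ᵇ≡true : ∀ {i j} → i ℤ.≤ j → (i ℤ.≤ᵇ j) ≡ true
ℤ≤⇒≤ᵇ≡true i≤j = T⇒≡true (ℤₚ.≤⇒≤ᵇ i≤j)

ℤ≤ᵇ≡true⇒≤ : ∀ i j → (i ℤ.≤ᵇ j) ≡ true → i ℤ.≤ j
ℤ≤ᵇ≡true⇒≤ i j e = ℤₚ.≤ᵇ⇒≤ (≡true⇒T e)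

private
  x-1+1≡x : ∀ x → x ℤ.- + 1 ℤ.+ + 1 ≡ x
  x-1+1≡x = solve-∀
  x-0+0≡x : ∀ x → x ℤ.- + 0 ℤ.+ + 0 ≡ x
  x-0+0≡x = solve-∀
  x-0+1≡x+1 : ∀ x → x ℤ.- + 0 ℤ.+ + 1 ≡ x ℤ.+ + 1
  x-0+1≡x+1 = solve-∀
  x-1+0≡x-1 : ∀ x → x ℤ.- + 1 ℤ.+ + 0 ≡ x ℤ.- + 1
  x-1+0≡x-1 = solve-∀

-- Fixing a column changes d_i into d_i − [i ≤ c_j] + [i ∈ column].
shift-cancel : ∀ x a b → a ≡ b → x ℤ.- + ind a ℤ.+ + ind b ≡ x
shift-cancel x true  .true  refl = x-1+1≡x x
shift-cancel x false .false refl = x-0+0≡x x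

shift-nonneg : ∀ x a b → + 0 ℤ.≤ x → (a ≡ true → b ≡ false → + 0 ℤ.< x) → + 0 ℤ.≤ x ℤ.- + ind a ℤ.+ + ind b
shift-nonneg x true  true  0≤x _   = subst (+ 0 ℤ.≤_) (sym (x-1+1≡x x)) 0≤x
shift-nonneg x false false 0≤x _   = subst (+ 0 ℤ.≤_) (sym (x-0+0≡x x)) 0≤x
shift-nonneg x false true  0≤x _   = subst (+ 0 ℤ.≤_) (sym (x-0+1≡x+1 x)) (ℤₚ.≤-trans 0≤x (ℤₚ.i≤i+j x (+ 1)))
shift-nonneg x true  false _   0<x = subst (+ 0 ℤ.≤_) (sym (x-1+0≡x-1 x)) (i<j⇒i≤j-1 (0<x refl refl))

shift-nonpos : ∀ x a b → x ℤ.< + 0 → x ℤ.- + ind a ℤ.+ + ind b ℤ.≤ + 0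
shift-nonpos x true  true  x<0 = subst (ℤ._≤ + 0) (sym (x-1+1≡x x)) (ℤₚ.<⇒≤ x<0)
shift-nonpos x false false x<0 = subst (ℤ._≤ + 0) (sym (x-0+0≡x x)) (ℤₚ.<⇒≤ x<0)
shift-nonpos x false true  x<0 = subst (ℤ._≤ + 0) (sym (x-0+1≡x+1 x)) (i<j⇒i+1≤j x<0)
shift-nonpos x true  false x<0 = subst (ℤ._≤ + 0) (sym (x-1+0≡x-1 x)) (ℤₚ.≤-trans (ℤₚ.i-j≤i x (+ 1)) (ℤₚ.<⇒≤ x<0))

module Analysis (m n : ℕ) (c : ℕ → ℤ)
  (c-nat : ∀ j → 1 ≤ j → j ≤ n → Σ ℕ λ h → c j ≡ + h × h ≤ m) where

  open Procedure m n c

  reaches-≤ᵇ : ∀ {j h} i → c j ≡ + h → reaches j i ≡ (i ≤ᵇ h)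
  reaches-≤ᵇ i c≡h rewrite c≡h = refl

  reaches-≤ : ∀ j {i k} → i ≤ k → reaches j k ≡ true → reaches j i ≡ true
  reaches-≤ j {i} {k} i≤k e = ℤ≤⇒≤ᵇ≡true (ℤₚ.≤-trans (ℤ.+≤+ i≤k) (ℤ≤ᵇ≡true⇒≤ (+ k) (c j) e))

  bℕ : State → ℕ → ℕ
  bℕ s i = count (λ j → J s j ∧ reaches j i) n

  J∧reaches-≤ : ∀ s j {i k} → i ≤ k → (J s j ∧ reaches j k) ≡ true → (J s j ∧ reaches j i) ≡ true
  J∧reaches-≤ s j i≤k e with J s j
  ... | true = reaches-≤ j i≤k e

  bℕ-antitone : ∀ s {i k} → i ≤ k → bℕ s k ≤ bℕ s i
  bℕ-antitone s i≤k = count-mono n (λ j → J∧reaches-≤ s j i≤k)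

  ColumnsInRange : State → Set
  ColumnsInRange s = ∀ j → J s j ≡ true → 1 ≤ j × j ≤ n

  bℕ-beyond-m : ∀ s → ColumnsInRange s → ∀ i → m < i → bℕ s i ≡ 0
  bℕ-beyond-m s J-in i m<i = count-none n short
    where
    short : ∀ j → 1 ≤ j → j ≤ n → (J s j ∧ reaches j i) ≡ false
    short j _ _ with J s j in e
    ... | false = refl
    ... | true with c-nat j (proj₁ (J-in j e)) (proj₂ (J-in j e))
    ...   | h , c≡h , h≤m rewrite reaches-≤ᵇ i c≡h = >⇒≤ᵇ≡false (ℕₚ.≤-<-trans h≤m m<i)

  ∉[1,m]⇒>m : ∀ i → 1 ≤ i → inRange 1 m i ≡ false → m < i
  ∉[1,m]⇒>m i 1≤i e with i ≤ᵇ m in e₂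
  ... | false = ≤ᵇ≡false⇒> i m e₂
  ... | true  = contradiction (trans (sym (cong (_∧ true) (≤⇒≤ᵇ≡true 1≤i))) e) true≢false

  d≡b-rr : ∀ s → ColumnsInRange s → ∀ i → 1 ≤ i → d s i ≡ b s i ℤ.- rr s i
  d≡b-rr s J-in i 1≤i with inRange 1 m i in e
  ... | true  = refl
  ... | false rewrite bℕ-beyond-m s J-in i (∉[1,m]⇒>m i 1≤i e) = refl

  rr-beyond-m : ∀ s i → m < i → rr s i ≡ + 0
  rr-beyond-m s i m<i rewrite inRange-above 1 m<i = refl

  d≢0⇒inRange : ∀ s i → d s i ≢ + 0 → 1 ≤ i × i ≤ m
  d≢0⇒inRange s i d≢0 with inRange 1 m i in e
  ... | true  = inRange-elim 1 m i e
  ... | false = contradiction refl d≢0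

  -- d-dominance and d-total are the Gale–Ryser condition for the columns still in J and the current row sums.
  record Invariant (r : ℕ → ℤ) (s : State) (k : ℕ) : Set where
    field
      columns-in-range : ColumnsInRange s
      fixed-in-range   : ∀ j i → cont s j i ≡ true → (1 ≤ j × j ≤ n) × J s j ≡ false × (1 ≤ i × i ≤ m)
      fixed-colSum     : ∀ j → 1 ≤ j → j ≤ n → J s j ≡ false → + count (cont s j) m ≡ c j
      rowSum-split     : ∀ i → 1 ≤ i → i ≤ m → r i ≡ rows s i ℤ.+ + count (λ j → not (J s j) ∧ cont s j i) n
      rows-antitone    : ∀ i → 1 ≤ i → rr s (suc i) ℤ.≤ rr s i
      d-dominance      : ∀ k → + 0 ℤ.≤ prefixSum (d s) k
      d-total          : prefixSum (d s) m ≡ + 0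
      steps            : count (J s) n + k ≡ n

  ind-ℤ : ∀ x → (if x then + 1 else + 0) ≡ + ind x
  ind-ℤ true  = refl
  ind-ℤ false = refl

  -- col-ends is what keeps the current row sums nonincreasing once the column is removed.
  record Admissible (s : State) (h : ℕ) (col : ℕ → Bool) : Set where
    field
      col-in-range : ∀ i → col i ≡ true → 1 ≤ i × i ≤ m
      col-count    : count col m ≡ h
      col-ends     : ∀ i → 1 ≤ i → col i ≡ true → col (suc i) ≡ false → rr s (suc i) ℤ.< rr s i

  module FixColumn (r : ℕ → ℤ) (s : State) (k : ℕ) (inv : Invariant r s k)
                   (j : ℕ) (1≤j : 1 ≤ j) (j≤n : j ≤ n) (j∈J : J s j ≡ true)
                   (h : ℕ) (c≡h : c j ≡ + h) (h≤m : h ≤ m)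
                   (col : ℕ → Bool) (adm : Admissible s h col) where
    open Invariant inv
    open Admissible adm

    s′ : State
    s′ = fix s j col

    col-beyond-m : ∀ i → m < i → col i ≡ false
    col-beyond-m i m<i with col i in e
    ... | false = refl
    ... | true  = contradiction (proj₂ (col-in-range i e)) (ℕₚ.<⇒≱ m<i)

    J-fix : ∀ j′ → j′ ≢ j → (J s j′ ∧ not (j′ ≡ᵇ j)) ≡ J s j′
    J-fix j′ j′≢j rewrite ≢⇒≡ᵇ≡false j′ j j′≢j = Boolₚ.∧-identityʳ (J s j′)

    j∉J′ : J s′ j ≡ false
    j∉J′ rewrite ≡ᵇ-refl j = Boolₚ.∧-zeroʳ (J s j)

    bℕ-fix : ∀ i → bℕ s i ≡ bℕ s′ i + ind (i ≤ᵇ h)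
    bℕ-fix i =
      trans (count-insert (λ j′ → J s j′ ∧ reaches j′ i) (λ j′ → J s′ j′ ∧ reaches j′ i) j n 1≤j j≤n
                          (λ j′ j′≢j → cong (_∧ reaches j′ i) (sym (J-fix j′ j′≢j)))
                          (cong (_∧ reaches j i) j∉J′))
            (cong (λ x → bℕ s′ i + ind x) (trans (cong (_∧ reaches j i) j∈J) (reaches-≤ᵇ i c≡h)))

    d-fix : ∀ i → 1 ≤ i → d s′ i ≡ d s i ℤ.- + ind (i ≤ᵇ h) ℤ.+ + ind (col i)
    d-fix i 1≤i with inRange 1 m i in e
    ... | true rewrite bℕ-fix i | ind-ℤ (col i) =
      regroup (+ bℕ s′ i) (+ ind (i ≤ᵇ h)) (rows s i) (+ ind (col i))
      where
      regroup : ∀ a x r y → a ℤ.- (r ℤ.- y) ≡ a ℤ.+ x ℤ.- r ℤ.- x ℤ.+ y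
      regroup = solve-∀
    ... | false rewrite >⇒≤ᵇ≡false {i} {h} (ℕₚ.≤-<-trans h≤m (∉[1,m]⇒>m i 1≤i e))
                      | col-beyond-m i (∉[1,m]⇒>m i 1≤i e) = refl

    d-fix-total : prefixSum (d s′) m ≡ prefixSum (d s) m
    d-fix-total = begin
      prefixSum (d s′) m
        ≡⟨ prefixSum-cong m (λ i 1≤i _ → d-fix i 1≤i) ⟩
      prefixSum (λ i → d s i ℤ.- + ind (i ≤ᵇ h) ℤ.+ + ind (col i)) m
        ≡⟨ prefixSum-+ (λ i → d s i ℤ.- + ind (i ≤ᵇ h)) (λ i → + ind (col i)) m ⟩
      prefixSum (λ i → d s i ℤ.- + ind (i ≤ᵇ h)) m ℤ.+ prefixSum (λ i → + ind (col i)) m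
        ≡⟨ cong₂ ℤ._+_ (prefixSum-- (d s) (λ i → + ind (i ≤ᵇ h)) m) (prefixSum-ind col m) ⟩
      prefixSum (d s) m ℤ.- prefixSum (λ i → + ind (i ≤ᵇ h)) m ℤ.+ + count col m
        ≡⟨ cong₂ (λ x y → prefixSum (d s) m ℤ.- x ℤ.+ + y)
                 (trans (prefixSum-ind (λ i → i ≤ᵇ h) m) (cong +_ (count-≤ᵇ h m h≤m))) col-count ⟩
      prefixSum (d s) m ℤ.- + h ℤ.+ + h
        ≡⟨ i-j+j≡i (prefixSum (d s) m) (+ h) ⟩
      prefixSum (d s) m ∎
      where open ≡-Reasoning

    rr-fix : ∀ i → 1 ≤ i → rr s′ i ≡ rr s i ℤ.- + ind (col i)
    rr-fix i 1≤i with inRange 1 m i in e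
    ... | true  = cong (λ x → rows s i ℤ.- x) (ind-ℤ (col i))
    ... | false rewrite col-beyond-m i (∉[1,m]⇒>m i 1≤i e) = refl

    rows-antitone′ : ∀ i → 1 ≤ i → rr s′ (suc i) ℤ.≤ rr s′ i
    rows-antitone′ i 1≤i rewrite rr-fix i 1≤i | rr-fix (suc i) (ℕₚ.m≤n⇒m≤1+n 1≤i)
      with col i in e₁ | col (suc i) in e₂
    ... | true  | true  = ℤₚ.+-monoˡ-≤ (ℤ.- + 1) (rows-antitone i 1≤i)
    ... | false | false = ℤₚ.+-monoˡ-≤ (+ 0) (rows-antitone i 1≤i)
    ... | false | true  = ℤₚ.≤-trans (ℤₚ.i-j≤i (rr s (suc i)) (+ 1))
                                    (ℤₚ.≤-trans (rows-antitone i 1≤i) (ℤₚ.≤-reflexive (sym (ℤₚ.+-identityʳ _))))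
    ... | true  | false = ℤₚ.≤-trans (ℤₚ.≤-reflexive (ℤₚ.+-identityʳ _)) (i<j⇒i≤j-1 (col-ends i 1≤i e₁ e₂))

    rowSum-split′ : ∀ i → 1 ≤ i → i ≤ m → r i ≡ rows s′ i ℤ.+ + count (λ j′ → not (J s′ j′) ∧ cont s′ j′ i) n
    rowSum-split′ i 1≤i i≤m =
      trans (rowSum-split i 1≤i i≤m)
            (trans (regroup (rows s i) (+ fixedBefore) (+ ind (col i)))
                   (cong₂ (λ x y → rows s i ℤ.- x ℤ.+ + y) (sym (ind-ℤ (col i))) (sym fixedAfter)))
      where
      fixedBefore : ℕ
      fixedBefore = count (λ j′ → not (J s j′) ∧ cont s j′ i) n
      fixedAfter : count (λ j′ → not (J s′ j′) ∧ cont s′ j′ i) n ≡ fixedBefore + ind (col i)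
      fixedAfter = trans (count-insert _ _ j n 1≤j j≤n same fixed-j) (cong (λ x → fixedBefore + ind x) fixed′-j)
        where
        same : ∀ j′ → j′ ≢ j → (not (J s′ j′) ∧ cont s′ j′ i) ≡ (not (J s j′) ∧ cont s j′ i)
        same j′ j′≢j rewrite ≢⇒≡ᵇ≡false j′ j j′≢j | Boolₚ.∧-identityʳ (J s j′) = refl
        fixed-j : (not (J s j) ∧ cont s j i) ≡ false
        fixed-j rewrite j∈J = refl
        fixed′-j : (not (J s′ j) ∧ cont s′ j i) ≡ col i
        fixed′-j rewrite ≡ᵇ-refl j | j∈J = refl
      regroup : ∀ x a y → x ℤ.+ a ≡ x ℤ.- y ℤ.+ (a ℤ.+ y)
      regroup = solve-∀

    steps′ : count (J s′) n + suc k ≡ n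
    steps′ = begin
      count (J s′) n + suc k   ≡⟨ ℕₚ.+-assoc (count (J s′) n) 1 k ⟨
      count (J s′) n + 1 + k   ≡⟨ cong (_+ k) removed ⟨
      count (J s) n + k        ≡⟨ steps ⟩
      n                        ∎
      where
      open ≡-Reasoning
      removed : count (J s) n ≡ count (J s′) n + 1
      removed = trans (count-insert (J s) (J s′) j n 1≤j j≤n (λ j′ j′≢j → sym (J-fix j′ j′≢j)) j∉J′)
                      (cong (λ x → count (J s′) n + ind x) j∈J)

    fixed-in-range′ : ∀ j′ i → cont s′ j′ i ≡ true → (1 ≤ j′ × j′ ≤ n) × J s′ j′ ≡ false × (1 ≤ i × i ≤ m)
    fixed-in-range′ j′ i e with j′ ≡ᵇ j in eq
    ... | true with ≡ᵇ≡true⇒≡ j′ j eq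
    ...   | refl = (1≤j , j≤n) , Boolₚ.∧-zeroʳ (J s j) , col-in-range i e
    fixed-in-range′ j′ i e | false with fixed-in-range j′ i e
    ... | j′-in , j′∉J , i-in rewrite j′∉J = j′-in , refl , i-in

    fixed-colSum′ : ∀ j′ → 1 ≤ j′ → j′ ≤ n → J s′ j′ ≡ false → + count (cont s′ j′) m ≡ c j′
    fixed-colSum′ j′ 1≤j′ j′≤n e with j′ ≡ᵇ j in eq
    ... | true with ≡ᵇ≡true⇒≡ j′ j eq
    ...   | refl = trans (cong +_ col-count) (sym c≡h)
    fixed-colSum′ j′ 1≤j′ j′≤n e | false =
      fixed-colSum j′ 1≤j′ j′≤n (trans (sym (Boolₚ.∧-identityʳ (J s j′))) e)

    invariant′ : (∀ k → + 0 ℤ.≤ prefixSum (d s′) k) → Invariant r s′ (suc k)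
    invariant′ dominance′ = record
      { columns-in-range = λ j′ e → columns-in-range j′ (∧-true-l e)
      ; fixed-in-range   = fixed-in-range′
      ; fixed-colSum     = fixed-colSum′
      ; rowSum-split     = rowSum-split′
      ; rows-antitone    = rows-antitone′
      ; d-dominance      = dominance′
      ; d-total          = trans d-fix-total d-total
      ; steps            = steps′
      }

  module RangeFacts (r : ℕ → ℤ) (s : State) (k : ℕ) (inv : Invariant r s k) (R : Ranges s) where
    open Invariant inv
    open Ranges R

    d≡b-rr′ : ∀ i → 1 ≤ i → d s i ≡ b s i ℤ.- rr s i
    d≡b-rr′ = d≡b-rr s columns-in-range

    i1-in : 1 ≤ i1 × i1 ≤ m
    i1-in = d≢0⇒inRange s i1 (≢-sym (ℤₚ.<⇒≢ (proj₁ i1-min)))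
    i2-in : 1 ≤ i2 × i2 ≤ m
    i2-in = d≢0⇒inRange s i2 (≢-sym (ℤₚ.<⇒≢ (proj₁ (proj₁ i2-min))))
    i3-in : 1 ≤ i3 × i3 ≤ m
    i3-in = d≢0⇒inRange s i3 (ℤₚ.<⇒≢ (proj₁ i3-min))
    i4-in : 1 ≤ i4 × i4 ≤ m
    i4-in = d≢0⇒inRange s i4 (ℤₚ.<⇒≢ (proj₁ (proj₁ i4-min)))

    d≤0-below-i1 : ∀ i → i < i1 → d s i ℤ.≤ + 0
    d≤0-below-i1 i i<i1 = ℤₚ.≮⇒≥ (proj₂ i1-min i i<i1)

    d≥0-below-i3 : ∀ i → i < i3 → + 0 ℤ.≤ d s i
    d≥0-below-i3 i i<i3 = ℤₚ.≮⇒≥ (proj₂ i3-min i i<i3)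

    i1≤i2 : i1 ≤ i2
    i1≤i2 = ℕₚ.≮⇒≥ (λ i2<i1 → proj₂ i1-min i2 i2<i1 (proj₁ (proj₁ i2-min)))

    i3≤i4 : i3 ≤ i4
    i3≤i4 = ℕₚ.≮⇒≥ (λ i4<i3 → proj₂ i3-min i4 i4<i3 (proj₁ (proj₁ i4-min)))

    d>0-on-R⁺ : ∀ i → i1 ≤ i → i ≤ i2 → + 0 ℤ.< d s i
    d>0-on-R⁺ = induction-on-interval (proj₁ i1-min) step
      where
      step : ∀ i → i1 ≤ i → i < i2 → + 0 ℤ.< d s i → + 0 ℤ.< d s (suc i)
      step i _ i<i2 pos with + 0 ℤ.<? d s (suc i)
      ... | yes pos′ = pos′
      ... | no  pos′ = contradiction (pos , ℤₚ.≮⇒≥ pos′) (proj₂ i2-min i i<i2)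

    d<0-on-R⁻ : ∀ i → i3 ≤ i → i ≤ i4 → d s i ℤ.< + 0
    d<0-on-R⁻ = induction-on-interval (proj₁ i3-min) step
      where
      step : ∀ i → i3 ≤ i → i < i4 → d s i ℤ.< + 0 → d s (suc i) ℤ.< + 0
      step i _ i<i4 neg with d s (suc i) ℤ.<? + 0
      ... | yes neg′ = neg′
      ... | no  neg′ = contradiction (neg , ℤₚ.≮⇒≥ neg′) (proj₂ i4-min i i<i4)

    -- By dominance the first nonzero d_i is positive.
    i1<i3 : i1 < i3
    i1<i3 = ℕₚ.≰⇒> i3≮i1
      where
      i3≮i1 : i3 ≤ i1 → ⊥
      i3≮i1 i3≤i1 with ℕₚ.m≤n⇒m<n∨m≡n i3≤i1
      ... | inj₂ refl = ℤₚ.<-asym (proj₁ i1-min) (proj₁ i3-min)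
      ... | inj₁ i3<i1 with i3 | proj₁ i3-in | proj₁ i3-min | d-dominance i3
      ...   | suc i | _ | neg | dom =
        ℤₚ.<⇒≱ (ℤₚ.+-mono-≤-< (prefixSum-nonpos-tail (d s) z≤n
                                 (λ i′ _ i′≤i → d≤0-below-i1 i′ (ℕₚ.≤-<-trans i′≤i (ℕₚ.<-trans (ℕₚ.n<1+n i) i3<i1))))
                               neg)
               dom

    i2<i3 : i2 < i3
    i2<i3 = ℕₚ.≰⇒> λ i3≤i2 → ℤₚ.<-asym (d>0-on-R⁺ i3 (ℕₚ.<⇒≤ i1<i3) i3≤i2) (proj₁ i3-min)

    rr-drop-before-i1 : ∀ i → suc i ≡ i1 → 1 ≤ i → rr s i1 ℤ.< rr s i
    rr-drop-before-i1 i 1+i≡i1 1≤i =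
      ℤₚ.<-≤-trans (0<i-j⇒j<i (b s i1) (rr s i1) (subst (+ 0 ℤ.<_) (d≡b-rr′ i1 (proj₁ i1-in)) (proj₁ i1-min)))
        (ℤₚ.≤-trans (ℤ.+≤+ (bℕ-antitone s (subst (i ≤_) 1+i≡i1 (ℕₚ.n≤1+n i))))
          (ℤₚ.i-j≤0⇒i≤j (subst (ℤ._≤ + 0) (d≡b-rr′ i 1≤i) (d≤0-below-i1 i (subst (i <_) 1+i≡i1 (ℕₚ.n<1+n i))))))

    rr-drop-after-i4 : rr s (suc i4) ℤ.< rr s i4
    rr-drop-after-i4 =
      ℤₚ.≤-<-trans (ℤₚ.0≤i-j⇒j≤i (subst (+ 0 ℤ.≤_) (d≡b-rr′ (suc i4) (s≤s z≤n)) (proj₂ (proj₁ i4-min))))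
        (ℤₚ.≤-<-trans (ℤ.+≤+ (bℕ-antitone s (ℕₚ.n≤1+n i4)))
          (i-j<0⇒i<j (b s i4) (rr s i4) (subst (ℤ._< + 0) (d≡b-rr′ i4 (proj₁ i4-in)) (proj₁ (proj₁ i4-min)))))

    bℕ-drop-after-i2 : bℕ s (suc i2) < bℕ s i2
    bℕ-drop-after-i2 = ℤₚ.drop‿+<+
      (ℤₚ.≤-<-trans (ℤₚ.i-j≤0⇒i≤j (subst (ℤ._≤ + 0) (d≡b-rr′ (suc i2) (s≤s z≤n)) (proj₂ (proj₁ i2-min))))
        (ℤₚ.≤-<-trans (rows-antitone i2 (proj₁ i2-in))
          (0<i-j⇒j<i (b s i2) (rr s i2) (subst (+ 0 ℤ.<_) (d≡b-rr′ i2 (proj₁ i2-in)) (proj₁ (proj₁ i2-min))))))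

    bℕ-drop-before-i3 : ∀ i → suc i ≡ i3 → bℕ s i3 < bℕ s i
    bℕ-drop-before-i3 i 1+i≡i3 = ℤₚ.drop‿+<+
      (ℤₚ.<-≤-trans (i-j<0⇒i<j (b s i3) (rr s i3) (subst (ℤ._< + 0) (d≡b-rr′ i3 (proj₁ i3-in)) (proj₁ i3-min)))
        (ℤₚ.≤-trans (subst (λ i′ → rr s i′ ℤ.≤ rr s i) 1+i≡i3 (rows-antitone i 1≤i))
          (ℤₚ.0≤i-j⇒j≤i (subst (+ 0 ℤ.≤_) (d≡b-rr′ i 1≤i) (d≥0-below-i3 i (subst (i <_) 1+i≡i3 (ℕₚ.n<1+n i)))))))
      where
      1≤i : 1 ≤ i
      1≤i = ℕₚ.≤-trans (proj₁ i1-in) (ℕₚ.≤-pred (subst (i1 <_) (sym 1+i≡i3) i1<i3))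

    rr-antitone : ∀ {i i′} → 1 ≤ i → i ≤ i′ → rr s i′ ℤ.≤ rr s i
    rr-antitone {i} 1≤i i≤i′ = induction-on-interval {P = λ i′ → rr s i′ ℤ.≤ rr s i} ℤₚ.≤-refl
      (λ i″ i≤i″ _ rr≤ → ℤₚ.≤-trans (rows-antitone i″ (ℕₚ.≤-trans 1≤i i≤i″)) rr≤) _ i≤i′ ℕₚ.≤-refl

  -- A-steps

  record AIndexSpec (s : State) (i3 sz : ℕ) (I : ℕ → Bool) : Set where
    field
      top      : ℕ
      i3≤top   : i3 ≤ top
      top≤m    : top ≤ m
      I-in     : ∀ i → I i ≡ true → i3 ≤ i × i ≤ top
      I-count  : count I m ≡ sz + 1
      d<0-upto : ∀ i → i3 ≤ i → i ≤ top → d s i ℤ.< + 0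
      I-ends   : ∀ i → I i ≡ true → I (suc i) ≡ false → rr s (suc i) ℤ.< rr s i

  module AStep (r : ℕ → ℤ) (s : State) (k : ℕ) (inv : Invariant r s k) (R : Ranges s)
               (short : Ranges.i2 R ∸ Ranges.i1 R ≤ Ranges.i4 R ∸ Ranges.i3 R)
               (h : ℕ) (i1≤h : Ranges.i1 R ≤ h) (h≤i2 : h ≤ Ranges.i2 R) where
    open Invariant inv
    open Ranges R
    open RangeFacts r s k inv R

    sz : ℕ
    sz = h ∸ i1

    V W : ℕ
    W = i3 + (sz + 1)
    V = W ∸ 1

    W≡1+i3+sz : W ≡ suc (i3 + sz)
    W≡1+i3+sz = trans (cong (λ x → i3 + x) (ℕₚ.+-comm sz 1)) (ℕₚ.+-suc i3 sz)

    V≡i3+sz : V ≡ i3 + sz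
    V≡i3+sz = cong (_∸ 1) W≡1+i3+sz

    W≡1+V : W ≡ suc V
    W≡1+V = trans W≡1+i3+sz (cong suc (sym V≡i3+sz))

    i3≤V : i3 ≤ V
    i3≤V = subst (i3 ≤_) (sym V≡i3+sz) (ℕₚ.m≤m+n i3 sz)

    1≤V : 1 ≤ V
    1≤V = ℕₚ.≤-trans (proj₁ i3-in) i3≤V

    V≤i4 : V ≤ i4
    V≤i4 = subst (_≤ i4) (sym V≡i3+sz)
             (subst (i3 + sz ≤_) (ℕₚ.m+[n∸m]≡n i3≤i4) (ℕₚ.+-monoʳ-≤ i3 (ℕₚ.≤-trans (ℕₚ.∸-monoˡ-≤ i1 h≤i2) short)))

    V≤m : V ≤ m
    V≤m = ℕₚ.≤-trans V≤i4 (proj₂ i4-in)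

    d<0-at-V : d s V ℤ.< + 0
    d<0-at-V = d<0-on-R⁻ V i3≤V V≤i4

    rr-V-pos : + 0 ℤ.< rr s V
    rr-V-pos = ℤₚ.≤-<-trans (ℤ.+≤+ z≤n) (i-j<0⇒i<j (b s V) (rr s V) (subst (ℤ._< + 0) (d≡b-rr′ V 1≤V) d<0-at-V))

    spec-simple : rr s W ℤ.< rr s V → AIndexSpec s i3 sz (inRange i3 V)
    spec-simple drop = record
      { top      = V
      ; i3≤top   = i3≤V
      ; top≤m    = V≤m
      ; I-in     = inRange-elim i3 V
      ; I-count  = count-interval-length i3 V (sz + 1) m (proj₁ i3-in) W≡1+V V≤m
      ; d<0-upto = λ i i3≤i i≤V → d<0-on-R⁻ i i3≤i (ℕₚ.≤-trans i≤V V≤i4)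
      ; I-ends   = ends
      }
      where
      ends : ∀ i → inRange i3 V i ≡ true → inRange i3 V (suc i) ≡ false → rr s (suc i) ℤ.< rr s i
      ends i e₁ e₂ with inRange-last i3 V i e₁ e₂
      ... | refl = subst (λ x → rr s x ℤ.< rr s V) W≡1+V drop

    spec-split : ∀ t1 t2 → IsMin (λ t → (i3 ≤ t × t ≤ V) × rr s t ≡ rr s V) t1 →
                 W ≤ t2 → rr s t2 ≡ rr s V → rr s t2 ℤ.> rr s (suc t2) →
                 AIndexSpec s i3 sz (λ i → inRange i3 (t1 ∸ 1) i ∨ inRange (t2 + t1 + 1 ∸ W) t2 i)
    spec-split t1 t2 (((i3≤t1 , t1≤V) , rr-t1≡) , t1-min) W≤t2 rr-t2≡ t2-drop = record
      { top      = t2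
      ; i3≤top   = ℕₚ.≤-trans (ℕₚ.m≤m+n i3 (sz + 1)) W≤t2
      ; top≤m    = t2≤m
      ; I-in     = I-in
      ; I-count  = trans (count-two-intervals i3 (t1 ∸ 1) t3 t2 m (proj₁ i3-in) (ℕₚ.<-trans t1∸1<t1 t1<t3)
                                              (ℕₚ.≤-trans (ℕₚ.m∸n≤m t1 1) (ℕₚ.≤-trans t1≤V V≤m)) t2≤m)
                         (trans (proj₂ arith) (ℕₚ.m+n∸m≡n i3 (sz + 1)))
      ; d<0-upto = d<0-upto
      ; I-ends   = ends
      }
      where
      t3 : ℕ
      t3 = t2 + t1 + 1 ∸ W
      1≤t1 : 1 ≤ t1
      1≤t1 = ℕₚ.≤-trans (proj₁ i3-in) i3≤t1
      t1∸1<t1 : t1 ∸ 1 < t1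
      t1∸1<t1 = ℕₚ.≤-reflexive (suc[n∸1]≡n 1≤t1)
      t1<W : t1 < W
      t1<W = subst (t1 <_) (sym W≡1+V) (s≤s t1≤V)
      arith : t1 < t3 × (suc (t1 ∸ 1) ∸ i3) + (suc t2 ∸ t3) ≡ W ∸ i3
      arith = a-split-arith i3 t1 W t2 (t1 ∸ i3) (W ∸ suc t1) (t2 ∸ W) (proj₁ i3-in)
                (ℕₚ.m+[n∸m]≡n i3≤t1) (ℕₚ.m+[n∸m]≡n t1<W) (ℕₚ.m+[n∸m]≡n W≤t2)
      t1<t3 : t1 < t3
      t1<t3 = proj₁ arith
      t2≤m : t2 ≤ m
      t2≤m = ℕₚ.≮⇒≥ λ m<t2 → ℤₚ.<⇒≢ rr-V-pos (trans (sym (rr-beyond-m s t2 m<t2)) rr-t2≡)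

      I-in : ∀ i → (inRange i3 (t1 ∸ 1) i ∨ inRange t3 t2 i) ≡ true → i3 ≤ i × i ≤ t2
      I-in i e with inRange i3 (t1 ∸ 1) i in e₁
      ... | true  = proj₁ (inRange-elim i3 (t1 ∸ 1) i e₁) ,
                    ℕₚ.≤-trans (proj₂ (inRange-elim i3 (t1 ∸ 1) i e₁))
                               (ℕₚ.≤-trans (ℕₚ.<⇒≤ (ℕₚ.<-trans t1∸1<t1 t1<W)) W≤t2)
      ... | false = ℕₚ.≤-trans i3≤t1 (ℕₚ.≤-trans (ℕₚ.<⇒≤ t1<t3) (proj₁ (inRange-elim t3 t2 i e))) ,
                    proj₂ (inRange-elim t3 t2 i e)

      -- Beyond V the rows keep the value r_V while b can only decrease, so d stays negative.
      d<0-upto : ∀ i → i3 ≤ i → i ≤ t2 → d s i ℤ.< + 0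
      d<0-upto i i3≤i i≤t2 with i ℕ.≤? V
      ... | yes i≤V = d<0-on-R⁻ i i3≤i (ℕₚ.≤-trans i≤V V≤i4)
      ... | no  i≰V =
        ℤₚ.≤-<-trans (subst (ℤ._≤ b s V ℤ.- rr s V) (sym (d≡b-rr′ i 1≤i))
                       (ℤₚ.+-mono-≤ (ℤ.+≤+ (bℕ-antitone s (ℕₚ.<⇒≤ (ℕₚ.≰⇒> i≰V))))
                                    (ℤₚ.neg-mono-≤ (subst (ℤ._≤ rr s i) rr-t2≡ (rr-antitone 1≤i i≤t2)))))
                     (subst (ℤ._< + 0) (d≡b-rr′ V 1≤V) d<0-at-V)
        where
        1≤i : 1 ≤ i
        1≤i = ℕₚ.≤-trans (proj₁ i3-in) i3≤i

      -- t1 is the first row of its block of equal row sums, so the row sums drop just before it.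
      drop-before-t1 : i3 ≤ t1 ∸ 1 → rr s (suc (t1 ∸ 1)) ℤ.< rr s (t1 ∸ 1)
      drop-before-t1 i3≤t1∸1 =
        ℤₚ.≤∧≢⇒< (rows-antitone (t1 ∸ 1) (ℕₚ.≤-trans (proj₁ i3-in) i3≤t1∸1))
          (λ eq → t1-min (t1 ∸ 1) t1∸1<t1
                    ((i3≤t1∸1 , ℕₚ.≤-trans (ℕₚ.m∸n≤m t1 1) t1≤V) ,
                     trans (sym eq) (trans (cong (rr s) (suc[n∸1]≡n 1≤t1)) rr-t1≡)))

      ends : ∀ i → (inRange i3 (t1 ∸ 1) i ∨ inRange t3 t2 i) ≡ true →
             (inRange i3 (t1 ∸ 1) (suc i) ∨ inRange t3 t2 (suc i)) ≡ false → rr s (suc i) ℤ.< rr s i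
      ends i e₁ e₂ with inRange i3 (t1 ∸ 1) i in e
      ... | true with inRange-last i3 (t1 ∸ 1) i e (∨-false-l e₂)
      ...   | refl = drop-before-t1 (proj₁ (inRange-elim i3 (t1 ∸ 1) (t1 ∸ 1) e))
      ends i e₁ e₂ | false with inRange-last t3 t2 i e₁ (∨-false-r e₂)
      ... | refl = t2-drop

    spec : ∀ I → AIndex s i3 (sz + 1) I → AIndexSpec s i3 sz I
    spec _ (a-simple drop)                              = spec-simple drop
    spec _ (a-split _ t1 t2 t1-min W≤t2 rr-t2≡ t2-drop) = spec-split t1 t2 t1-min W≤t2 rr-t2≡ t2-drop

    index : Σ (ℕ → Bool) (AIndex s i3 (sz + 1))
    index with rr s W ℤ.<? rr s V
    ... | yes drop = _ , a-simple drop
    ... | no ¬drop = _ , a-split ¬drop t1 t2 t1-min W≤t2 rr-t2≡ t2-drop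
      where
      SameAsV : ℕ → Set
      SameAsV t = (i3 ≤ t × t ≤ V) × rr s t ≡ rr s V
      first : ∃ (IsMin SameAsV)
      first = minimal (λ t → ((i3 ℕ.≤? t) ×-dec (t ℕ.≤? V)) ×-dec (rr s t ℤₚ.≟ rr s V)) V ((i3≤V , ℕₚ.≤-refl) , refl)
      t1 : ℕ
      t1 = proj₁ first
      t1-min : IsMin SameAsV t1
      t1-min = proj₂ first
      rr-W≡ : rr s W ≡ rr s V
      rr-W≡ = ℤₚ.≤-antisym (subst (λ x → rr s x ℤ.≤ rr s V) (sym W≡1+V) (rows-antitone V 1≤V)) (ℤₚ.≮⇒≥ ¬drop)
      InRun : ℕ → Set
      InRun t = W ≤ t × rr s t ≡ rr s V
      run-bounded : ∀ t → InRun t → t ≤ m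
      run-bounded t (_ , rr-t≡) = ℕₚ.≮⇒≥ λ m<t → ℤₚ.<⇒≢ rr-V-pos (trans (sym (rr-beyond-m s t m<t)) rr-t≡)
      last : ∃ λ t → InRun t × ¬ InRun (suc t)
      last = lastOfRun (λ t → (W ℕ.≤? t) ×-dec (rr s t ℤₚ.≟ rr s V)) m run-bounded W (ℕₚ.≤-refl , rr-W≡)
      t2 : ℕ
      t2 = proj₁ last
      W≤t2 : W ≤ t2
      W≤t2 = proj₁ (proj₁ (proj₂ last))
      rr-t2≡ : rr s t2 ≡ rr s V
      rr-t2≡ = proj₂ (proj₁ (proj₂ last))
      t2-drop : rr s (suc t2) ℤ.< rr s t2
      t2-drop = ℤₚ.≤∧≢⇒< (rows-antitone t2 (ℕₚ.≤-trans 1≤V (ℕₚ.≤-trans (ℕₚ.n≤1+n V) (subst (_≤ t2) W≡1+V W≤t2))))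
                         (λ eq → proj₂ (proj₂ last) (ℕₚ.≤-trans W≤t2 (ℕₚ.n≤1+n t2) , trans eq rr-t2≡))

    module Column (j : ℕ) (1≤j : 1 ≤ j) (j≤n : j ≤ n) (j∈J : J s j ≡ true) (c≡h : c j ≡ + h) (h≤m : h ≤ m)
                  (I : ℕ → Bool) (I-spec : AIndexSpec s i3 sz I) where
      open AIndexSpec I-spec

      col : ℕ → Bool
      col i = inRange 1 (i1 ∸ 1) i ∨ I i

      i1∸1<i3 : ∀ {i} → i ≤ i1 ∸ 1 → i < i3
      i1∸1<i3 i≤ = ℕₚ.≤-<-trans (ℕₚ.≤-trans i≤ (ℕₚ.m∸n≤m i1 1)) i1<i3

      I-below-i3 : ∀ i → i < i3 → I i ≡ false
      I-below-i3 i i<i3 with I i in e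
      ... | false = refl
      ... | true  = contradiction (proj₁ (I-in i e)) (ℕₚ.<⇒≱ i<i3)

      admissible : Admissible s h col
      admissible = record { col-in-range = in-range ; col-count = counted ; col-ends = ends }
        where
        in-range : ∀ i → col i ≡ true → 1 ≤ i × i ≤ m
        in-range i e with inRange 1 (i1 ∸ 1) i in e₁
        ... | true  = proj₁ (inRange-elim 1 (i1 ∸ 1) i e₁) ,
                      ℕₚ.≤-trans (proj₂ (inRange-elim 1 (i1 ∸ 1) i e₁)) (ℕₚ.≤-trans (ℕₚ.m∸n≤m i1 1) (proj₂ i1-in))
        ... | false = ℕₚ.≤-trans (proj₁ i3-in) (proj₁ (I-in i e)) , ℕₚ.≤-trans (proj₂ (I-in i e)) top≤m
        counted : count col m ≡ h
        counted =
          trans (count-∨-disjoint (inRange 1 (i1 ∸ 1)) I m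
                  (λ i e → I-below-i3 i (i1∸1<i3 (proj₂ (inRange-elim 1 (i1 ∸ 1) i e)))))
                (trans (cong₂ _+_ (count-interval 1 (i1 ∸ 1) m (s≤s z≤n) (ℕₚ.≤-trans (ℕₚ.m∸n≤m i1 1) (proj₂ i1-in)))
                                  I-count)
                       ([n∸1]+[h∸n+1]≡h i1 h (proj₁ i1-in) i1≤h))
        ends : ∀ i → 1 ≤ i → col i ≡ true → col (suc i) ≡ false → rr s (suc i) ℤ.< rr s i
        ends i 1≤i e₁ e₂ with inRange 1 (i1 ∸ 1) i in e
        ... | true with inRange-last 1 (i1 ∸ 1) i e (∨-false-l e₂)
        ...   | refl = subst (λ x → rr s x ℤ.< rr s (i1 ∸ 1)) (sym (suc[n∸1]≡n (proj₁ i1-in)))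
                             (rr-drop-before-i1 (i1 ∸ 1) (suc[n∸1]≡n (proj₁ i1-in)) 1≤i)
        ends i 1≤i e₁ e₂ | false = I-ends i e₁ (∨-false-r e₂)

      open FixColumn r s k inv j 1≤j j≤n j∈J h c≡h h≤m col admissible

      -- The column loses the rows i1 … h ⊆ R⁺ (where d > 0) and gains the rows of I ⊆ [i3 , top] (where d < 0).
      invariant : Invariant r s′ (suc k)
      invariant = invariant′ (prefixSum-nonneg-redistribute (d s) (d s′) top≤m d-dominance d-fix-total
                                unchanged-low nonneg nonpos unchanged-high)
        where
        unchanged-low : ∀ i → 1 ≤ i → i < i1 → d s′ i ≡ d s i
        unchanged-low i 1≤i i<i1 = trans (d-fix i 1≤i) (shift-cancel (d s i) (i ≤ᵇ h) (col i)
          (trans (≤⇒≤ᵇ≡true (ℕₚ.≤-trans (ℕₚ.<⇒≤ i<i1) i1≤h))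
                 (sym (∨-true-l (inRange-intro 1≤i (ℕₚ.≤-pred (subst (suc i ≤_) (sym (suc[n∸1]≡n (proj₁ i1-in))) i<i1)))))))
        nonneg : ∀ i → i1 ≤ i → i < i3 → + 0 ℤ.≤ d s′ i
        nonneg i i1≤i i<i3 = subst (+ 0 ℤ.≤_) (sym (d-fix i (ℕₚ.≤-trans (proj₁ i1-in) i1≤i)))
          (shift-nonneg (d s i) (i ≤ᵇ h) (col i) (d≥0-below-i3 i i<i3)
            (λ e _ → d>0-on-R⁺ i i1≤i (ℕₚ.≤-trans (≤ᵇ≡true⇒≤ i h e) h≤i2)))
        nonpos : ∀ i → i3 < i → i ≤ top → d s′ i ℤ.≤ + 0
        nonpos i i3<i i≤top = subst (ℤ._≤ + 0) (sym (d-fix i (ℕₚ.≤-trans (s≤s z≤n) i3<i)))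
          (shift-nonpos (d s i) (i ≤ᵇ h) (col i) (d<0-upto i (ℕₚ.<⇒≤ i3<i) i≤top))
        unchanged-high : ∀ i → top < i → d s′ i ≡ d s i
        unchanged-high i top<i = trans (d-fix i (ℕₚ.≤-trans (s≤s z≤n) top<i))
          (shift-cancel (d s i) (i ≤ᵇ h) (col i) (trans (>⇒≤ᵇ≡false (ℕₚ.≤-<-trans h≤i2 (ℕₚ.<-trans i2<i3 i3<i))) (sym col-i)))
          where
          i3<i : i3 < i
          i3<i = ℕₚ.≤-<-trans i3≤top top<i
          col-i : col i ≡ false
          col-i with inRange 1 (i1 ∸ 1) i in e
          ... | true  = contradiction (i1∸1<i3 (proj₂ (inRange-elim 1 (i1 ∸ 1) i e))) (ℕₚ.<-asym i3<i)
          ... | false with I i in e′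
          ...   | false = refl
          ...   | true  = contradiction (proj₂ (I-in i e′)) (ℕₚ.<⇒≱ top<i)

  -- B-steps

  record BIndexSpec (s : State) (i1 i2 sB : ℕ) (I : ℕ → Bool) : Set where
    field
      I-in     : ∀ i → I i ≡ true → i1 ≤ i × i ≤ i2
      I-count  : count I m ≡ sB
      I-starts : ∀ i → 1 ≤ i → I i ≡ false → I (suc i) ≡ true → rr s (suc i) ℤ.< rr s i

  module BStep (r : ℕ → ℤ) (s : State) (k : ℕ) (inv : Invariant r s k) (R : Ranges s)
               (long : Ranges.i4 R ∸ Ranges.i3 R < Ranges.i2 R ∸ Ranges.i1 R)
               (h : ℕ) (i3≤h+1 : Ranges.i3 R ≤ h + 1) (h+1≤i4 : h + 1 ≤ Ranges.i4 R) where
    open Invariant inv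
    open Ranges R
    open RangeFacts r s k inv R

    sB : ℕ
    sB = i4 ∸ h

    p0 : ℕ
    p0 = i2 ∸ sB

    sB+i1≤i2 : sB + i1 ≤ i2
    sB+i1≤i2 = ℕₚ.m≤o∸n⇒m+n≤o sB i1≤i2
      (ℕₚ.≤-trans (ℕₚ.∸-monoʳ-≤ (suc i4) (subst (i3 ≤_) (ℕₚ.+-comm h 1) i3≤h+1))
                  (ℕₚ.≤-trans (ℕₚ.≤-reflexive (ℕₚ.+-∸-assoc 1 i3≤i4)) long))

    i1≤p0 : i1 ≤ p0
    i1≤p0 = ℕₚ.m+n≤o⇒m≤o∸n i1 (subst (_≤ i2) (ℕₚ.+-comm sB i1) sB+i1≤i2)

    p0+sB≡i2 : p0 + sB ≡ i2
    p0+sB≡i2 = ℕₚ.m∸n+n≡m (ℕₚ.≤-trans (ℕₚ.m≤m+n sB i1) sB+i1≤i2)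

    1≤p0 : 1 ≤ p0
    1≤p0 = ℕₚ.≤-trans (proj₁ i1-in) i1≤p0

    h<i4 : h < i4
    h<i4 = subst (_≤ i4) (ℕₚ.+-comm h 1) h+1≤i4

    spec-simple : rr s p0 ℤ.> rr s (suc p0) → BIndexSpec s i1 i2 sB (inRange (suc p0) i2)
    spec-simple drop = record
      { I-in     = λ i e → ℕₚ.≤-trans (ℕₚ.≤-trans i1≤p0 (ℕₚ.n≤1+n p0)) (proj₁ (inRange-elim (suc p0) i2 i e)) ,
                           proj₂ (inRange-elim (suc p0) i2 i e)
      ; I-count  = count-interval-length (suc p0) i2 sB m (s≤s z≤n) (cong suc p0+sB≡i2) (proj₂ i2-in)
      ; I-starts = starts
      }
      where
      starts : ∀ i → 1 ≤ i → inRange (suc p0) i2 i ≡ false → inRange (suc p0) i2 (suc i) ≡ true →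
               rr s (suc i) ℤ.< rr s i
      starts i _ e₁ e₂ with inRange-first (suc p0) i2 i e₁ e₂
      ... | refl = drop

    spec-split : ∀ t1 t2 → (suc p0 ≤ t1 × t1 ≤ i2) × rr s t1 ≡ rr s (suc p0) →
                 (∀ t → t1 < t → t ≤ i2 → ¬ (rr s t ≡ rr s (suc p0))) →
                 1 ≤ t2 → t2 ≤ p0 → rr s t2 ≡ rr s (suc p0) → (t2 ≡ 1 ⊎ rr s (t2 ∸ 1) ℤ.> rr s t2) →
                 BIndexSpec s i1 i2 sB (λ i → inRange t2 (t2 + sB + t1 ∸ suc i2) i ∨ inRange (suc t1) i2 i)
    spec-split t1 t2 ((p0<t1 , t1≤i2) , rr-t1≡) t1-max 1≤t2 t2≤p0 rr-t2≡ t2-first = record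
      { I-in     = I-in
      ; I-count  = trans (count-two-intervals t2 t3 (suc t1) i2 m 1≤t2 (ℕₚ.m≤n⇒m≤1+n t3<t1)
                                              (ℕₚ.≤-trans (ℕₚ.<⇒≤ t3<t1) (ℕₚ.≤-trans t1≤i2 (proj₂ i2-in))) (proj₂ i2-in))
                         (proj₂ arith)
      ; I-starts = starts
      }
      where
      t3 : ℕ
      t3 = t2 + sB + t1 ∸ suc i2
      arith : t3 < t1 × (suc t3 ∸ t2) + (i2 ∸ t1) ≡ sB
      arith = b-split-arith t2 p0 t1 i2 sB (p0 ∸ t2) (t1 ∸ suc p0) (i2 ∸ t1)
                (ℕₚ.m+[n∸m]≡n t2≤p0) (ℕₚ.m+[n∸m]≡n p0<t1) (ℕₚ.m+[n∸m]≡n t1≤i2) p0+sB≡i2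
      t3<t1 : t3 < t1
      t3<t1 = proj₁ arith

      -- Row i1 − 1 has a strictly larger row sum than rows i1 … p0 + 1, so the block of t2 starts at i1 or later.
      i1≤t2 : i1 ≤ t2
      i1≤t2 = ℕₚ.≮⇒≥ λ t2<i1 → ℤₚ.<-irrefl refl
        (ℤₚ.≤-<-trans (ℤₚ.≤-trans (ℤₚ.≤-reflexive rr-t2≡) (rr-antitone (proj₁ i1-in) (ℕₚ.≤-trans i1≤p0 (ℕₚ.n≤1+n p0))))
          (ℤₚ.<-≤-trans (rr-drop-before-i1 (i1 ∸ 1) (suc[n∸1]≡n (proj₁ i1-in)) (ℕₚ.≤-trans 1≤t2 (t2≤i1∸1 t2<i1)))
                        (rr-antitone 1≤t2 (t2≤i1∸1 t2<i1))))
        where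
        t2≤i1∸1 : t2 < i1 → t2 ≤ i1 ∸ 1
        t2≤i1∸1 t2<i1 = ℕₚ.≤-pred (subst (t2 <_) (sym (suc[n∸1]≡n (proj₁ i1-in))) t2<i1)

      I-in : ∀ i → (inRange t2 t3 i ∨ inRange (suc t1) i2 i) ≡ true → i1 ≤ i × i ≤ i2
      I-in i e with inRange t2 t3 i in e₁
      ... | true  = ℕₚ.≤-trans i1≤t2 (proj₁ (inRange-elim t2 t3 i e₁)) ,
                    ℕₚ.≤-trans (proj₂ (inRange-elim t2 t3 i e₁)) (ℕₚ.≤-trans (ℕₚ.<⇒≤ t3<t1) t1≤i2)
      ... | false = ℕₚ.≤-trans i1≤p0 (ℕₚ.≤-trans (ℕₚ.n≤1+n p0) (ℕₚ.≤-trans p0<t1 (ℕₚ.≤-trans (ℕₚ.n≤1+n t1)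
                      (proj₁ (inRange-elim (suc t1) i2 i e))))) ,
                    proj₂ (inRange-elim (suc t1) i2 i e)

      starts : ∀ i → 1 ≤ i → (inRange t2 t3 i ∨ inRange (suc t1) i2 i) ≡ false →
               (inRange t2 t3 (suc i) ∨ inRange (suc t1) i2 (suc i)) ≡ true → rr s (suc i) ℤ.< rr s i
      starts i 1≤i e₁ e₂ with inRange t2 t3 (suc i) in e
      ... | true with inRange-first t2 t3 i (∨-false-l e₁) e
      ...   | refl = [ (λ 1+i≡1 → contradiction (sym 1+i≡1) (ℕₚ.<⇒≢ (s≤s 1≤i))) , (λ drop → drop) ]′ t2-first
      starts i 1≤i e₁ e₂ | false with inRange-first (suc t1) i2 i (∨-false-r e₁) e₂
      ... | refl = ℤₚ.≤∧≢⇒< (rows-antitone t1 (ℕₚ.≤-trans 1≤p0 (ℕₚ.≤-trans (ℕₚ.n≤1+n p0) p0<t1)))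
                     (λ eq → t1-max (suc t1) (ℕₚ.n<1+n t1) (proj₂ (inRange-elim (suc t1) i2 (suc t1) e₂)) (trans eq rr-t1≡))

    spec : ∀ I → BIndex s i2 sB I → BIndexSpec s i1 i2 sB I
    spec _ (b-simple drop) = spec-simple drop
    spec _ (b-split _ t1 t2 t1-in t1-max 1≤t2 t2≤p0 rr-t2≡ t2-first) =
      spec-split t1 t2 t1-in t1-max 1≤t2 t2≤p0 rr-t2≡ t2-first

    index : Σ (ℕ → Bool) (BIndex s i2 sB)
    index with rr s (suc p0) ℤ.<? rr s p0
    ... | yes drop = _ , b-simple drop
    ... | no ¬drop = _ , b-split ¬drop t1 t2 t1-in t1-max 1≤t2 t2≤p0 rr-t2≡ (first-of-block t2 1≤t2 rr-t2≡ t2-min)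
      where
      SameBelow : ℕ → Set
      SameBelow t = 1 ≤ t × rr s t ≡ rr s (suc p0)
      SameAbove : ℕ → Set
      SameAbove t = (suc p0 ≤ t × t ≤ i2) × rr s t ≡ rr s (suc p0)

      1+p0≤i2 : suc p0 ≤ i2
      1+p0≤i2 = subst (suc p0 ≤_) p0+sB≡i2
                  (subst (_≤ p0 + sB) (ℕₚ.+-comm p0 1) (ℕₚ.+-monoʳ-≤ p0 (ℕₚ.m<n⇒0<n∸m h<i4)))

      after : ∃ λ t → SameAbove t × t ≤ i2 × (∀ t′ → t < t′ → t′ ≤ i2 → ¬ SameAbove t′)
      after = greatest (λ t → ((suc p0 ℕ.≤? t) ×-dec (t ℕ.≤? i2)) ×-dec (rr s t ℤₚ.≟ rr s (suc p0)))
                       i2 (suc p0) 1+p0≤i2 ((ℕₚ.≤-refl , 1+p0≤i2) , refl)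
      t1 : ℕ
      t1 = proj₁ after
      t1-in : SameAbove t1
      t1-in = proj₁ (proj₂ after)
      t1-max : ∀ t → t1 < t → t ≤ i2 → ¬ (rr s t ≡ rr s (suc p0))
      t1-max t t1<t t≤i2 eq =
        proj₂ (proj₂ (proj₂ after)) t t1<t t≤i2 ((ℕₚ.≤-trans (proj₁ (proj₁ t1-in)) (ℕₚ.<⇒≤ t1<t) , t≤i2) , eq)

      rr-p0≡ : rr s p0 ≡ rr s (suc p0)
      rr-p0≡ = ℤₚ.≤-antisym (ℤₚ.≮⇒≥ ¬drop) (rows-antitone p0 1≤p0)

      before : ∃ (IsMin SameBelow)
      before = minimal (λ t → (1 ℕ.≤? t) ×-dec (rr s t ℤₚ.≟ rr s (suc p0))) p0 (1≤p0 , rr-p0≡)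
      t2 : ℕ
      t2 = proj₁ before
      1≤t2 : 1 ≤ t2
      1≤t2 = proj₁ (proj₁ (proj₂ before))
      rr-t2≡ : rr s t2 ≡ rr s (suc p0)
      rr-t2≡ = proj₂ (proj₁ (proj₂ before))
      t2-min : ∀ t → t < t2 → ¬ SameBelow t
      t2-min = proj₂ (proj₂ before)
      t2≤p0 : t2 ≤ p0
      t2≤p0 = ℕₚ.≮⇒≥ λ p0<t2 → t2-min p0 p0<t2 (1≤p0 , rr-p0≡)

      first-of-block : ∀ t → 1 ≤ t → rr s t ≡ rr s (suc p0) → (∀ t′ → t′ < t → ¬ SameBelow t′) →
                       t ≡ 1 ⊎ rr s (t ∸ 1) ℤ.> rr s t
      first-of-block (suc zero)    _ _   _      = inj₁ refl
      first-of-block (suc (suc t)) _ rr≡ t-min =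
        inj₂ (ℤₚ.≤∧≢⇒< (rows-antitone (suc t) (s≤s z≤n))
                       (λ eq → t-min (suc t) ℕₚ.≤-refl (s≤s z≤n , trans (sym eq) rr≡)))

    module Column (j : ℕ) (1≤j : 1 ≤ j) (j≤n : j ≤ n) (j∈J : J s j ≡ true) (c≡h : c j ≡ + h) (h≤m : h ≤ m)
                  (I : ℕ → Bool) (I-spec : BIndexSpec s i1 i2 sB I) where
      open BIndexSpec I-spec

      col : ℕ → Bool
      col i = ((1 ℕ.≤ᵇ i) ∧ (+ i ℤ.≤ᵇ c j) ∧ not (I i)) ∨ ((c j ℤ.+ + 1 ℤ.≤ᵇ + i) ∧ (i ℕ.≤ᵇ i4))

      kept added : ℕ → Bool
      kept i  = (1 ℕ.≤ᵇ i) ∧ (i ≤ᵇ h) ∧ not (I i)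
      added i = inRange (h + 1) i4 i

      col≡ : ∀ i → col i ≡ (kept i ∨ added i)
      col≡ i rewrite c≡h = refl

      i2≤h : i2 ≤ h
      i2≤h = ℕₚ.≤-pred (subst (i2 <_) (ℕₚ.+-comm h 1) (ℕₚ.<-≤-trans i2<i3 i3≤h+1))

      I-in′ : ∀ i → I i ≡ true → 1 ≤ i × i ≤ h
      I-in′ i e = ℕₚ.≤-trans (proj₁ i1-in) (proj₁ (I-in i e)) , ℕₚ.≤-trans (proj₂ (I-in i e)) i2≤h

      kept-in : ∀ i → kept i ≡ true → 1 ≤ i × i ≤ h
      kept-in i e with 1 ℕ.≤ᵇ i in e₁ | i ≤ᵇ h in e₂
      ... | true | true = ≤ᵇ≡true⇒≤ 1 i e₁ , ≤ᵇ≡true⇒≤ i h e₂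

      kept-or-moved : ∀ i → 1 ≤ i → i ≤ h → kept i ≡ (not (I i))
      kept-or-moved i 1≤i i≤h rewrite ≤⇒≤ᵇ≡true 1≤i | ≤⇒≤ᵇ≡true i≤h = refl

      not-kept⇒I : ∀ i → 1 ≤ i → i ≤ h → kept i ≡ false → I i ≡ true
      not-kept⇒I i 1≤i i≤h e with I i | kept-or-moved i 1≤i i≤h
      ... | true | _ = refl
      ... | false | eq = contradiction (trans (sym eq) e) true≢false

      ¬I⇒kept : ∀ i → 1 ≤ i → i ≤ h → I i ≡ false → kept i ≡ true
      ¬I⇒kept i 1≤i i≤h e = trans (kept-or-moved i 1≤i i≤h) (cong not e)

      kept⇒¬I : ∀ i → kept i ≡ true → I i ≡ false
      kept⇒¬I i e with 1 ℕ.≤ᵇ i | i ≤ᵇ h | I i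
      ... | true | true | false = refl

      kept-count : count kept m + sB ≡ h
      kept-count = begin
        count kept m + sB                              ≡⟨ cong (λ x → count kept m + x) I-count ⟨
        count kept m + count I m                       ≡⟨ count-pointwise-+ kept I (inRange 1 h) (λ _ → false) m pointwise ⟩
        count (inRange 1 h) m + count (λ _ → false) m  ≡⟨ cong₂ _+_ (count-interval 1 h m (s≤s z≤n) h≤m)
                                                                   (count-none m (λ _ _ _ → refl)) ⟩
        h + 0                                          ≡⟨ ℕₚ.+-identityʳ h ⟩
        h                                              ∎
        where
        open ≡-Reasoning
        pointwise : ∀ i → ind (kept i) + ind (I i) ≡ ind (inRange 1 h i) + 0
        pointwise i with I i in e
        ... | true rewrite inRange-intro (proj₁ (I-in′ i e)) (proj₂ (I-in′ i e))
                         | Boolₚ.∧-zeroʳ (i ≤ᵇ h) | Boolₚ.∧-zeroʳ (1 ℕ.≤ᵇ i) = refl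
        ... | false rewrite Boolₚ.∧-identityʳ (i ≤ᵇ h) = refl

      h+1≤ : ∀ {i} → h < i → h + 1 ≤ i
      h+1≤ {i} h<i = subst (_≤ i) (ℕₚ.+-comm 1 h) h<i

      added-in : ∀ i → added i ≡ true → h < i × i ≤ i4
      added-in i e = subst (_≤ i) (ℕₚ.+-comm h 1) (proj₁ (inRange-elim (h + 1) i4 i e)) ,
                     proj₂ (inRange-elim (h + 1) i4 i e)

      added-of : ∀ i → col i ≡ true → kept i ≡ false → added i ≡ true
      added-of i e ¬kept = trans (cong (_∨ added i) (sym ¬kept)) (trans (sym (col≡ i)) e)

      col-≤i4 : ∀ i → col i ≡ true → i ≤ i4
      col-≤i4 i e with kept i in e₁
      ... | true  = ℕₚ.≤-trans (proj₂ (kept-in i e₁)) (ℕₚ.<⇒≤ h<i4)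
      ... | false = proj₂ (added-in i (added-of i e e₁))

      admissible : Admissible s h col
      admissible = record { col-in-range = in-range ; col-count = counted ; col-ends = ends }
        where
        in-range : ∀ i → col i ≡ true → 1 ≤ i × i ≤ m
        in-range i e with kept i in e₁
        ... | true  = proj₁ (kept-in i e₁) , ℕₚ.≤-trans (proj₂ (kept-in i e₁)) h≤m
        ... | false = ℕₚ.≤-trans (s≤s z≤n) (proj₁ (added-in i (added-of i e e₁))) , ℕₚ.≤-trans (col-≤i4 i e) (proj₂ i4-in)
        counted : count col m ≡ h
        counted = begin
          count col m                         ≡⟨ count-cong m (λ i _ _ → col≡ i) ⟩
          count (λ i → kept i ∨ added i) m    ≡⟨ count-∨-disjoint kept added m
                                                   (λ i e → inRange-below (subst (i <_) (ℕₚ.+-comm 1 h) (s≤s (proj₂ (kept-in i e))))) ⟩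
          count kept m + count added m        ≡⟨ cong (λ x → count kept m + x)
                                                   (count-interval-length (h + 1) i4 sB m (ℕₚ.m≤n+m 1 h)
                                                     (trans (ℕₚ.+-assoc h 1 sB) (trans (ℕₚ.+-suc h sB) (cong suc (ℕₚ.m+[n∸m]≡n (ℕₚ.<⇒≤ h<i4)))))
                                                     (proj₂ i4-in)) ⟩
          count kept m + sB                   ≡⟨ kept-count ⟩
          h                                   ∎
          where open ≡-Reasoning
        ends : ∀ i → 1 ≤ i → col i ≡ true → col (suc i) ≡ false → rr s (suc i) ℤ.< rr s i
        ends i 1≤i e₁ e₂ with suc i ℕ.≤? h
        ... | yes i<h = I-starts i 1≤i (kept⇒¬I i kept-i) (not-kept⇒I (suc i) (s≤s z≤n) i<h (∨-false-l (trans (sym (col≡ (suc i))) e₂)))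
          where
          kept-i : kept i ≡ true
          kept-i with kept i in e
          ... | true  = refl
          ... | false = contradiction (proj₁ (added-in i (added-of i e₁ e))) (ℕₚ.<-asym i<h)
        ... | no i≮h with suc i ℕ.≤? i4
        ...   | yes i<i4 = contradiction (trans (sym (∨-true-r (inRange-intro (h+1≤ (ℕₚ.≰⇒> i≮h)) i<i4)))
                                                (trans (sym (col≡ (suc i))) e₂)) true≢false
        ...   | no  i≮i4 with ℕₚ.≤-antisym (col-≤i4 i e₁) (ℕₚ.≤-pred (ℕₚ.≰⇒> i≮i4))
        ...     | refl = rr-drop-after-i4

      open FixColumn r s k inv j 1≤j j≤n j∈J h c≡h h≤m col admissible

      -- The column loses the rows of I ⊆ R⁺ (where d > 0) and gains the rows h + 1 … i4 ⊆ R⁻ (where d < 0).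
      invariant : Invariant r s′ (suc k)
      invariant = invariant′ (prefixSum-nonneg-redistribute (d s) (d s′) (proj₂ i4-in) d-dominance d-fix-total
                                unchanged-low nonneg nonpos unchanged-high)
        where
        unchanged-low : ∀ i → 1 ≤ i → i < i1 → d s′ i ≡ d s i
        unchanged-low i 1≤i i<i1 = trans (d-fix i 1≤i) (shift-cancel (d s i) (i ≤ᵇ h) (col i)
          (trans (≤⇒≤ᵇ≡true i≤h) (sym (trans (col≡ i) (∨-true-l (¬I⇒kept i 1≤i i≤h ¬I))))))
          where
          i≤h : i ≤ h
          i≤h = ℕₚ.≤-trans (ℕₚ.<⇒≤ i<i1) (ℕₚ.≤-trans i1≤i2 i2≤h)
          ¬I : I i ≡ false
          ¬I with I i in e
          ... | false = refl
          ... | true  = contradiction (proj₁ (I-in i e)) (ℕₚ.<⇒≱ i<i1)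
        nonneg : ∀ i → i1 ≤ i → i < i3 → + 0 ℤ.≤ d s′ i
        nonneg i i1≤i i<i3 = subst (+ 0 ℤ.≤_) (sym (d-fix i 1≤i))
          (shift-nonneg (d s i) (i ≤ᵇ h) (col i) (d≥0-below-i3 i i<i3)
            (λ e₁ e₂ → d>0-on-R⁺ i i1≤i (proj₂ (I-in i (not-kept⇒I i 1≤i (≤ᵇ≡true⇒≤ i h e₁)
                                                          (∨-false-l (trans (sym (col≡ i)) e₂)))))))
          where
          1≤i : 1 ≤ i
          1≤i = ℕₚ.≤-trans (proj₁ i1-in) i1≤i
        nonpos : ∀ i → i3 < i → i ≤ i4 → d s′ i ℤ.≤ + 0
        nonpos i i3<i i≤i4 = subst (ℤ._≤ + 0) (sym (d-fix i (ℕₚ.≤-trans (s≤s z≤n) i3<i)))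
          (shift-nonpos (d s i) (i ≤ᵇ h) (col i) (d<0-on-R⁻ i (ℕₚ.<⇒≤ i3<i) i≤i4))
        unchanged-high : ∀ i → i4 < i → d s′ i ≡ d s i
        unchanged-high i i4<i = trans (d-fix i (ℕₚ.≤-trans (s≤s z≤n) i4<i))
          (shift-cancel (d s i) (i ≤ᵇ h) (col i) (trans (>⇒≤ᵇ≡false h<i) (sym col-i)))
          where
          h<i : h < i
          h<i = ℕₚ.<-trans h<i4 i4<i
          col-i : col i ≡ false
          col-i with col i in e
          ... | false = refl
          ... | true  = contradiction (col-≤i4 i e) (ℕₚ.<⇒≱ i4<i)

  ∣+a-+b∣≡a∸b : ∀ {a b} → b ≤ a → ℤ.∣ + a ℤ.- + b ∣ ≡ a ∸ b
  ∣+a-+b∣≡a∸b {a} {b} b≤a = cong ℤ.∣_∣ (trans (ℤₚ.m-n≡m⊖n a b) (ℤₚ.⊖-≥ b≤a))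

  Cand-height : ∀ s {off lo hi j h} → c j ≡ + h → Cand s (+ off) lo hi j → lo ≤ h + off × h + off ≤ hi
  Cand-height s c≡h (_ , _ , lo≤c+off , c+off≤hi) rewrite c≡h = ℤₚ.drop‿+≤+ lo≤c+off , ℤₚ.drop‿+≤+ c+off≤hi

  candA-height : ∀ s {lo hi j h} → c j ≡ + h → Cand s (+ 0) lo hi j → lo ≤ h × h ≤ hi
  candA-height s {h = h} c≡h cand with Cand-height s c≡h cand
  ... | lo≤h , h≤hi rewrite ℕₚ.+-identityʳ h = lo≤h , h≤hi

  sizeA : ∀ {j h i1} → c j ≡ + h → i1 ≤ h → ℤ.∣ c j ℤ.- + i1 ∣ + 1 ≡ (h ∸ i1) + 1
  sizeA {i1 = i1} c≡h i1≤h = cong (_+ 1) (trans (cong (λ x → ℤ.∣ x ℤ.- + i1 ∣) c≡h) (∣+a-+b∣≡a∸b i1≤h))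

  sizeB : ∀ {j h i4} → c j ≡ + h → h + 1 ≤ i4 → ℤ.∣ + i4 ℤ.- c j ∣ ≡ i4 ∸ h
  sizeB {h = h} {i4} c≡h h+1≤i4 =
    trans (cong (λ x → ℤ.∣ + i4 ℤ.- x ∣) c≡h) (∣+a-+b∣≡a∸b (ℕₚ.≤-trans (ℕₚ.m≤m+n h 1) h+1≤i4))

  step-preserves : ∀ r s s′ k → Invariant r s k → Step s s′ → Invariant r s′ (suc k)
  step-preserves r s _ k inv (stepA R short j cand@((1≤j , j≤n) , j∈J , _) _ I idx) with c-nat j 1≤j j≤n
  ... | h , c≡h , h≤m =
    Column.invariant j 1≤j j≤n j∈J c≡h h≤m I (spec I (subst (λ sA → AIndex s i3 sA I) (sizeA c≡h i1≤h) idx))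
    where
    open Ranges R
    i1≤h : i1 ≤ h
    i1≤h = proj₁ (candA-height s c≡h cand)
    open AStep r s k inv R short h i1≤h (proj₂ (candA-height s c≡h cand))
  step-preserves r s _ k inv (stepB R long j cand@((1≤j , j≤n) , j∈J , _) _ I idx) with c-nat j 1≤j j≤n
  ... | h , c≡h , h≤m =
    Column.invariant j 1≤j j≤n j∈J c≡h h≤m I (spec I (subst (λ sB → BIndex s i2 sB I) (sizeB c≡h h+1≤i4) idx))
    where
    open Ranges R
    h+1≤i4 : h + 1 ≤ i4
    h+1≤i4 = proj₂ (Cand-height s c≡h cand)
    open BStep r s k inv R long h (proj₁ (Cand-height s c≡h cand)) h+1≤i4

  run-preserves : ∀ r → Invariant r (init r) 0 → ∀ k s → Run (init r) k s → Invariant r s k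
  run-preserves r inv₀ _ _ done             = inv₀
  run-preserves r inv₀ _ _ (next run step) = step-preserves r _ _ _ (run-preserves r inv₀ _ _ run) step

  steps≤n : ∀ {r s k} → Invariant r s k → k ≤ n
  steps≤n {k = k} inv = subst (k ≤_) (Invariant.steps inv) (ℕₚ.m≤n+m k _)

  -- Progress

  column-of-height : ∀ s t → bℕ s (suc t) < bℕ s t → ∃ λ j → (1 ≤ j × j ≤ n) × J s j ≡ true × c j ≡ + t
  column-of-height s t drop
    with count-witness (λ j → J s j ∧ reaches j t) (λ j → J s j ∧ reaches j (suc t)) n
                       (λ j → J∧reaches-≤ s j (ℕₚ.n≤1+n t)) drop
  ... | j , (1≤j , j≤n) , reach-t , ¬reach-1+t with J s j in j∈J | c-nat j 1≤j j≤n
  ...   | true | h , c≡h , _ = j , (1≤j , j≤n) , j∈J , trans c≡h (cong +_ h≡t)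
    where
    h≡t : h ≡ t
    h≡t = ℕₚ.≤-antisym (ℕₚ.≤-pred (≤ᵇ≡false⇒> (suc t) h (trans (sym (reaches-≤ᵇ (suc t) c≡h)) ¬reach-1+t)))
                       (≤ᵇ≡true⇒≤ t h (trans (sym (reaches-≤ᵇ t c≡h)) reach-t))

  Cand? : ∀ s off lo hi j → Dec (Cand s off lo hi j)
  Cand? s off lo hi j = ((1 ℕ.≤? j) ×-dec (j ℕ.≤? n)) ×-dec
                        ((J s j Boolₚ.≟ true) ×-dec ((+ lo ℤₚ.≤? c j ℤ.+ off) ×-dec (c j ℤ.+ off ℤₚ.≤? + hi)))

  module Progress (r : ℕ → ℤ) (s : State) (k : ℕ) (inv : Invariant r s k) where
    open Invariant inv

    prefixSums-zero⇒stopped : (∀ k → k ≤ m → prefixSum (d s) k ≡ + 0) → Stopped s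
    prefixSums-zero⇒stopped sums≡0 (suc i) _ 1+i≤m =
      trans (sym (ℤₚ.+-identityˡ _))
            (trans (cong (ℤ._+ d s (suc i)) (sym (sums≡0 i (ℕₚ.≤-trans (ℕₚ.n≤1+n i) 1+i≤m)))) (sums≡0 (suc i) 1+i≤m))

    stopped-if-nonpos : (∀ i → 1 ≤ i → i ≤ m → d s i ℤ.≤ + 0) → Stopped s
    stopped-if-nonpos nonpos = prefixSums-zero⇒stopped λ k k≤m →
      ℤₚ.≤-antisym (prefixSum-nonpos-tail (d s) z≤n (λ i 1≤i i≤k → nonpos i 1≤i (ℕₚ.≤-trans i≤k k≤m))) (d-dominance k)

    stopped-if-nonneg : (∀ i → 1 ≤ i → i ≤ m → + 0 ℤ.≤ d s i) → Stopped s
    stopped-if-nonneg nonneg = prefixSums-zero⇒stopped λ k k≤m →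
      ℤₚ.≤-antisym (subst (prefixSum (d s) k ℤ.≤_) d-total
                     (prefixSum-nonneg-tail (d s) k≤m (λ i k<i i≤m → nonneg i (ℕₚ.≤-trans (s≤s z≤n) k<i) i≤m)))
                   (d-dominance k)

    positive? : ∀ i → Dec (+ 0 ℤ.< d s i)
    positive? i = + 0 ℤₚ.<? d s i
    negative? : ∀ i → Dec (d s i ℤ.< + 0)
    negative? i = d s i ℤₚ.<? + 0

    ranges : ∀ p q → + 0 ℤ.< d s p → d s q ℤ.< + 0 → Ranges s
    ranges p q pos neg = record
      { i1 = proj₁ first⁺ ; i2 = proj₁ last⁺ ; i3 = proj₁ first⁻ ; i4 = proj₁ last⁻
      ; i1-min = proj₂ first⁺ ; i2-min = proj₂ last⁺ ; i3-min = proj₂ first⁻ ; i4-min = proj₂ last⁻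
      }
      where
      End⁺ End⁻ : ℕ → Set
      End⁺ i = d s i ℤ.> + 0 × d s (suc i) ℤ.≤ + 0
      End⁻ i = d s i ℤ.< + 0 × d s (suc i) ℤ.≥ + 0
      first⁺ : ∃ (IsMin (λ i → d s i ℤ.> + 0))
      first⁺ = minimal positive? p pos
      first⁻ : ∃ (IsMin (λ i → d s i ℤ.< + 0))
      first⁻ = minimal negative? q neg
      end⁺ : ∃ λ i → + 0 ℤ.< d s i × ¬ (+ 0 ℤ.< d s (suc i))
      end⁺ = lastOfRun positive? m (λ i pos → proj₂ (d≢0⇒inRange s i (≢-sym (ℤₚ.<⇒≢ pos)))) p pos
      end⁻ : ∃ λ i → d s i ℤ.< + 0 × ¬ (d s (suc i) ℤ.< + 0)
      end⁻ = lastOfRun negative? m (λ i neg → proj₂ (d≢0⇒inRange s i (ℤₚ.<⇒≢ neg))) q neg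
      last⁺ : ∃ (IsMin End⁺)
      last⁺ = minimal (λ i → positive? i ×-dec (d s (suc i) ℤₚ.≤? + 0))
                      (proj₁ end⁺) (proj₁ (proj₂ end⁺) , ℤₚ.≮⇒≥ (proj₂ (proj₂ end⁺)))
      last⁻ : ∃ (IsMin End⁻)
      last⁻ = minimal (λ i → negative? i ×-dec (+ 0 ℤₚ.≤? d s (suc i)))
                      (proj₁ end⁻) (proj₁ (proj₂ end⁻) , ℤₚ.≮⇒≥ (proj₂ (proj₂ end⁻)))

    stepA-exists : (R : Ranges s) → Ranges.i2 R ∸ Ranges.i1 R ≤ Ranges.i4 R ∸ Ranges.i3 R → ∃ (λ s′ → Step s s′)
    stepA-exists R short = stepA-at j cand-j max-j
      where
      open Ranges R
      open RangeFacts r s k inv R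
      height-i2 : ∃ λ j → (1 ≤ j × j ≤ n) × J s j ≡ true × c j ≡ + i2
      height-i2 = column-of-height s i2 bℕ-drop-after-i2
      c+0≡i2 : c (proj₁ height-i2) ℤ.+ + 0 ≡ + i2
      c+0≡i2 = trans (ℤₚ.+-identityʳ _) (proj₂ (proj₂ (proj₂ height-i2)))
      largest : ∃ λ j → Cand s (+ 0) i1 i2 j × j ≤ n × (∀ j′ → j < j′ → j′ ≤ n → ¬ Cand s (+ 0) i1 i2 j′)
      largest = greatest (Cand? s (+ 0) i1 i2) n (proj₁ height-i2) (proj₂ (proj₁ (proj₂ height-i2)))
                  (proj₁ (proj₂ height-i2) , proj₁ (proj₂ (proj₂ height-i2)) ,
                   subst (+ i1 ℤ.≤_) (sym c+0≡i2) (ℤ.+≤+ i1≤i2) , ℤₚ.≤-reflexive c+0≡i2)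
      j : ℕ
      j = proj₁ largest
      cand-j : Cand s (+ 0) i1 i2 j
      cand-j = proj₁ (proj₂ largest)
      max-j : ∀ j′ → j < j′ → ¬ Cand s (+ 0) i1 i2 j′
      max-j j′ j<j′ cand = proj₂ (proj₂ (proj₂ largest)) j′ j<j′ (proj₂ (proj₁ cand)) cand

      stepA-at : ∀ j → Cand s (+ 0) i1 i2 j → (∀ j′ → j < j′ → ¬ Cand s (+ 0) i1 i2 j′) → ∃ (λ s′ → Step s s′)
      stepA-at j cand@((1≤j , j≤n) , _) max with c-nat j 1≤j j≤n
      ... | h , c≡h , _ = _ , stepA R short j cand max (proj₁ index)
                                   (subst (λ sA → AIndex s i3 sA (proj₁ index)) (sym (sizeA c≡h i1≤h)) (proj₂ index))
        where
        i1≤h : i1 ≤ h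
        i1≤h = proj₁ (candA-height s c≡h cand)
        open AStep r s k inv R short h i1≤h (proj₂ (candA-height s c≡h cand))

    stepB-exists : (R : Ranges s) → Ranges.i4 R ∸ Ranges.i3 R < Ranges.i2 R ∸ Ranges.i1 R → ∃ (λ s′ → Step s s′)
    stepB-exists R long = stepB-at j cand-j min-j
      where
      open Ranges R
      open RangeFacts r s k inv R
      height-i3-1 : ∃ λ j → (1 ≤ j × j ≤ n) × J s j ≡ true × c j ≡ + (i3 ∸ 1)
      height-i3-1 = column-of-height s (i3 ∸ 1)
                      (subst (λ i → bℕ s i < bℕ s (i3 ∸ 1)) (sym (suc[n∸1]≡n (proj₁ i3-in)))
                             (bℕ-drop-before-i3 (i3 ∸ 1) (suc[n∸1]≡n (proj₁ i3-in))))
      c+1≡i3 : c (proj₁ height-i3-1) ℤ.+ + 1 ≡ + i3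
      c+1≡i3 = trans (cong (ℤ._+ + 1) (proj₂ (proj₂ (proj₂ height-i3-1))))
                     (cong +_ (trans (ℕₚ.+-comm (i3 ∸ 1) 1) (suc[n∸1]≡n (proj₁ i3-in))))
      smallest : ∃ (IsMin (Cand s (+ 1) i3 i4))
      smallest = minimal (Cand? s (+ 1) i3 i4) (proj₁ height-i3-1)
                   (proj₁ (proj₂ height-i3-1) , proj₁ (proj₂ (proj₂ height-i3-1)) ,
                    ℤₚ.≤-reflexive (sym c+1≡i3) , subst (ℤ._≤ + i4) (sym c+1≡i3) (ℤ.+≤+ i3≤i4))
      j : ℕ
      j = proj₁ smallest
      cand-j : Cand s (+ 1) i3 i4 j
      cand-j = proj₁ (proj₂ smallest)
      min-j : ∀ j′ → j′ < j → ¬ Cand s (+ 1) i3 i4 j′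
      min-j = proj₂ (proj₂ smallest)

      stepB-at : ∀ j → Cand s (+ 1) i3 i4 j → (∀ j′ → j′ < j → ¬ Cand s (+ 1) i3 i4 j′) → ∃ (λ s′ → Step s s′)
      stepB-at j cand@((1≤j , j≤n) , _) min with c-nat j 1≤j j≤n
      ... | h , c≡h , _ = _ , stepB R long j cand min (proj₁ index)
                                   (subst (λ sB → BIndex s i2 sB (proj₁ index)) (sym (sizeB c≡h h+1≤i4)) (proj₂ index))
        where
        h+1≤i4 : h + 1 ≤ i4
        h+1≤i4 = proj₂ (Cand-height s c≡h cand)
        open BStep r s k inv R long h (proj₁ (Cand-height s c≡h cand)) h+1≤i4

    step-exists : Ranges s → ∃ (λ s′ → Step s s′)
    step-exists R with Ranges.i2 R ∸ Ranges.i1 R ℕ.≤? Ranges.i4 R ∸ Ranges.i3 R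
    ... | yes short = stepA-exists R short
    ... | no  ¬short = stepB-exists R (ℕₚ.≰⇒> ¬short)

    progress : Stopped s ⊎ ∃ (λ s′ → Step s s′)
    progress with ℕₚ.anyUpTo? positive? (suc m)
    ... | no none⁺ = inj₁ (stopped-if-nonpos λ i _ i≤m → ℤₚ.≮⇒≥ λ pos → none⁺ (i , s≤s i≤m , pos))
    ... | yes (p , _ , pos) with ℕₚ.anyUpTo? negative? (suc m)
    ...   | no none⁻ = contradiction (stopped-if-nonneg (λ i _ i≤m → ℤₚ.≮⇒≥ λ neg → none⁻ (i , s≤s i≤m , neg))
                                                       p (proj₁ p-in) (proj₂ p-in))
                                     (≢-sym (ℤₚ.<⇒≢ pos))
      where
      p-in : 1 ≤ p × p ≤ m
      p-in = d≢0⇒inRange s p (≢-sym (ℤₚ.<⇒≢ pos))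
    ...   | yes (q , _ , neg) = inj₂ (step-exists (ranges p q pos neg))

  -- The initial state

  module Initial (r : ℕ → ℤ) (F : ℕ → ℕ → Bool) (F-sums : HasSums m n r c F)
                 (r-antitone : ∀ i → 1 ≤ i → i < m → r (suc i) ℤ.≤ r i) where
    F-in : ∀ i j → F i j ≡ true → (1 ≤ i × i ≤ m) × (1 ≤ j × j ≤ n)
    F-in = proj₁ F-sums

    s₀ : State
    s₀ = init r

    F-beyond-m : ∀ i j → m < i → F i j ≡ false
    F-beyond-m i j m<i with F i j in e
    ... | false = refl
    ... | true  = contradiction (proj₂ (proj₁ (F-in i j e))) (ℕₚ.<⇒≱ m<i)

    rr₀ : ∀ i → 1 ≤ i → rr s₀ i ≡ + rowSum F n i
    rr₀ i 1≤i with inRange 1 m i in e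
    ... | true  = sym (proj₁ (proj₂ F-sums) i 1≤i (proj₂ (inRange-elim 1 m i e)))
    ... | false = cong +_ (sym (count-none n (λ j _ _ → F-beyond-m i j (∉[1,m]⇒>m i 1≤i e))))

    F₁ : ℕ → ℕ → Bool
    F₁ i j = inRange 1 n j ∧ reaches j i

    F₁-column : ∀ j → 1 ≤ j → j ≤ n → ∀ i → F₁ i j ≡ (i ≤ᵇ colSum F m j)
    F₁-column j 1≤j j≤n i rewrite inRange-intro {1} {n} {j} 1≤j j≤n =
      reaches-≤ᵇ i (sym (proj₂ (proj₂ F-sums) j 1≤j j≤n))

    -- Among the first k rows, column j of F has at most min(k , c_j) points, which is what F₁ has.
    F≤F₁-prefix : ∀ j → 1 ≤ j → j ≤ n → ∀ k → count (λ i → F i j) k ≤ count (λ i → F₁ i j) k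
    F≤F₁-prefix j 1≤j j≤n k rewrite count-cong k (λ i _ _ → F₁-column j 1≤j j≤n i) with k ℕ.≤? colSum F m j
    ... | yes k≤h = subst (count (λ i → F i j) k ≤_)
                          (sym (trans (count-cong k (λ i _ i≤k → ≤⇒≤ᵇ≡true (ℕₚ.≤-trans i≤k k≤h))) (count-all k)))
                          (count≤ _ k)
    ... | no  k≰h = subst (count (λ i → F i j) k ≤_)
                          (sym (count-≤ᵇ′ (ℕₚ.<⇒≤ (ℕₚ.≰⇒> k≰h))))
                          F-prefix≤h
      where
      count-≤ᵇ′ : colSum F m j ≤ k → count (λ i → i ≤ᵇ colSum F m j) k ≡ colSum F m j
      count-≤ᵇ′ h≤k = trans (count-truncate (colSum F m j) k h≤k (λ i h<i _ → >⇒≤ᵇ≡false h<i))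
                            (trans (count-cong (colSum F m j) (λ i _ i≤h → ≤⇒≤ᵇ≡true i≤h)) (count-all _))
      F-prefix≤h : count (λ i → F i j) k ≤ colSum F m j
      F-prefix≤h with k ℕ.≤? m
      ... | yes k≤m = count-monoʳ _ k≤m
      ... | no  k≰m = ℕₚ.≤-reflexive (count-truncate m k (ℕₚ.<⇒≤ (ℕₚ.≰⇒> k≰m)) (λ i m<i _ → F-beyond-m i j m<i))

    F≡F₁-column : ∀ j → 1 ≤ j → j ≤ n → count (λ i → F i j) m ≡ count (λ i → F₁ i j) m
    F≡F₁-column j 1≤j j≤n =
      sym (trans (count-cong m (λ i _ _ → F₁-column j 1≤j j≤n i)) (count-≤ᵇ (colSum F m j) m (count≤ _ m)))

    pointsF pointsF₁ : ℕ → ℕ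
    pointsF  k = sumℕ (λ j → count (λ i → F i j) k) n
    pointsF₁ k = sumℕ (λ j → count (λ i → F₁ i j) k) n

    prefixSum-d₀ : ∀ k → prefixSum (d s₀) k ≡ + pointsF₁ k ℤ.- + pointsF k
    prefixSum-d₀ k = begin
      prefixSum (d s₀) k
        ≡⟨ prefixSum-cong k (λ i 1≤i _ → trans (d≡b-rr s₀ (λ j → inRange-elim 1 n j) i 1≤i)
                                             (cong (λ x → b s₀ i ℤ.- x) (rr₀ i 1≤i))) ⟩
      prefixSum (λ i → b s₀ i ℤ.- + rowSum F n i) k
        ≡⟨ prefixSum-- (b s₀) (λ i → + rowSum F n i) k ⟩
      prefixSum (b s₀) k ℤ.- prefixSum (λ i → + rowSum F n i) k
        ≡⟨ cong₂ ℤ._-_ (trans (prefixSum-+ℕ (bℕ s₀) k) (cong +_ (sumℕ-count-swap F₁ k n)))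
                       (trans (prefixSum-+ℕ (rowSum F n) k) (cong +_ (sumℕ-count-swap F k n))) ⟩
      + pointsF₁ k ℤ.- + pointsF k ∎
      where open ≡-Reasoning

    rows-antitone₀ : ∀ i → 1 ≤ i → rr s₀ (suc i) ℤ.≤ rr s₀ i
    rows-antitone₀ i 1≤i with i ℕ.<? m
    ... | yes i<m rewrite inRange-intro {1} {m} {i} 1≤i (ℕₚ.<⇒≤ i<m) | inRange-intro {1} {m} {suc i} (s≤s z≤n) i<m =
      r-antitone i 1≤i i<m
    ... | no  i≮m rewrite rr-beyond-m s₀ (suc i) (s≤s (ℕₚ.≮⇒≥ i≮m)) | rr₀ i 1≤i = ℤ.+≤+ z≤n

    invariant₀ : Invariant r s₀ 0
    invariant₀ = record
      { columns-in-range = λ j → inRange-elim 1 n j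
      ; fixed-in-range   = λ _ _ ()
      ; fixed-colSum     = λ j 1≤j j≤n e → contradiction (trans (sym (inRange-intro 1≤j j≤n)) e) true≢false
      ; rowSum-split     = λ i _ _ → sym (trans (cong (λ x → r i ℤ.+ + x) (count-none n (λ _ _ _ → Boolₚ.∧-zeroʳ _)))
                                               (ℤₚ.+-identityʳ (r i)))
      ; rows-antitone    = rows-antitone₀
      ; d-dominance      = λ k → subst (+ 0 ℤ.≤_) (sym (prefixSum-d₀ k))
                                   (ℤₚ.i≤j⇒0≤j-i (ℤ.+≤+ (sumℕ-mono n (λ j 1≤j j≤n → F≤F₁-prefix j 1≤j j≤n k))))
      ; d-total          = trans (prefixSum-d₀ m)
                                 (ℤₚ.i≡j⇒i-j≡0 (cong +_ (sumℕ-cong n (λ j 1≤j j≤n → sym (F≡F₁-column j 1≤j j≤n)))))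
      ; steps            = trans (ℕₚ.+-identityʳ _) (count-interval 1 n n (s≤s z≤n) ℕₚ.≤-refl)
      }

  -- The final state

  final-sums : ∀ r s k → Invariant r s k → Stopped s → HasSums m n r c (F₂ s)
  final-sums r s k inv stopped = in-range , row-sums , column-sums
    where
    open Invariant inv

    in-range : ∀ i j → F₂ s i j ≡ true → (1 ≤ i × i ≤ m) × (1 ≤ j × j ≤ n)
    in-range i j e with J s j in j∈J
    ... | false = let (j-in , _ , i-in) = fixed-in-range j i e in i-in , j-in
    ... | true with columns-in-range j j∈J
    ...   | 1≤j , j≤n with c-nat j 1≤j j≤n | 1 ℕ.≤ᵇ i in e₁
    ...     | h , c≡h , h≤m | true =
      (≤ᵇ≡true⇒≤ 1 i e₁ , ℕₚ.≤-trans (≤ᵇ≡true⇒≤ i h (trans (sym (reaches-≤ᵇ i c≡h)) e)) h≤m) , (1≤j , j≤n)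

    row-sums : ∀ i → 1 ≤ i → i ≤ m → + rowSum (F₂ s) n i ≡ r i
    row-sums i 1≤i i≤m = sym (begin
      r i                                                   ≡⟨ rowSum-split i 1≤i i≤m ⟩
      rows s i ℤ.+ + fixed                                  ≡⟨ cong (ℤ._+ + fixed) rows≡b ⟩
      b s i ℤ.+ + fixed                                     ≡⟨ cong +_ (sym split) ⟩
      + rowSum (F₂ s) n i                                   ∎)
      where
      open ≡-Reasoning
      fixed : ℕ
      fixed = count (λ j → not (J s j) ∧ cont s j i) n
      split : rowSum (F₂ s) n i ≡ bℕ s i + fixed
      split = trans (sym (trans (cong (λ x → rowSum (F₂ s) n i + x) (count-none n (λ _ _ _ → refl))) (ℕₚ.+-identityʳ _)))
                    (count-pointwise-+ (λ j → F₂ s i j) (λ _ → false) (λ j → J s j ∧ reaches j i)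
                                       (λ j → not (J s j) ∧ cont s j i) n pointwise)
        where
        pointwise : ∀ j → ind (F₂ s i j) + 0 ≡ ind (J s j ∧ reaches j i) + ind (not (J s j) ∧ cont s j i)
        pointwise j with J s j
        ... | true rewrite ≤⇒≤ᵇ≡true 1≤i = trans (ℕₚ.+-identityʳ _) (sym (ℕₚ.+-identityʳ _))
        ... | false = ℕₚ.+-identityʳ _
      rows≡b : rows s i ≡ b s i
      rows≡b = sym (ℤₚ.i-j≡0⇒i≡j _ _ (trans d≡ (stopped i 1≤i i≤m)))
        where
        d≡ : b s i ℤ.- rows s i ≡ d s i
        d≡ rewrite inRange-intro {1} {m} {i} 1≤i i≤m = refl

    column-sums : ∀ j → 1 ≤ j → j ≤ n → + colSum (F₂ s) m j ≡ c j
    column-sums j 1≤j j≤n with J s j in j∈J | c-nat j 1≤j j≤n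
    ... | false | _ = fixed-colSum j 1≤j j≤n j∈J
    ... | true  | h , c≡h , h≤m =
      trans (cong +_ (trans (count-cong m (λ i _ _ → cong ((1 ℕ.≤ᵇ i) ∧_) (reaches-≤ᵇ i c≡h)))
                            (count-interval 1 h m (s≤s z≤n) h≤m)))
            (sym c≡h)

theorem1 : (m n : ℕ) (r c : ℕ → ℤ) →
    1 ≤ m → 1 ≤ n →
    r 1 ≡ + n → (∀ i → 1 ≤ i → i < m → r (suc i) ≤ℤ r i) →
    c 1 ≡ + m → (∀ j → 1 ≤ j → j < n → c (suc j) ≤ℤ c j) →
    Consistent m n r c →
    let open Procedure m n c in
      (∀ k s → Run (init r) k s → Stopped s ⊎ ∃ (λ s' → Step s s'))
      × (∀ k s → Run (init r) k s → k ≤ n)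
      × (∀ k s → Run (init r) k s → Stopped s → HasSums m n r c (F₂ s))
theorem1 m n r c _ _ _ r-antitone _ _ (F , F-sums) =
  (λ k s run → Progress.progress r s k (invariant k s run)) ,
  (λ k s run → steps≤n (invariant k s run)) ,
  (λ k s run → final-sums r s k (invariant k s run))
  where
  c-nat : ∀ j → 1 ≤ j → j ≤ n → Σ ℕ λ h → c j ≡ + h × h ≤ m
  c-nat j 1≤j j≤n = colSum F m j , sym (proj₂ (proj₂ F-sums) j 1≤j j≤n) , count≤ _ m
  open Procedure m n c
  open Analysis m n c c-nat
  invariant : ∀ k s → Run (init r) k s → Invariant r s k
  invariant = run-preserves r (Initial.invariant₀ r F F-sums r-antitone)
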